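{- Let $\pi_1,\dots,\pi_m$ be permutations and $t_1,\dots,t_m$ reals with $\sum_{i\in[m]}t_iP_{\pi_i}=0$, and let $k=\max\{|\pi_1|,\dots,|\pi_m|\}$. Suppose that $\pi_1,\dots,\pi_n$ are exactly those among $\pi_1,\dots,\pi_m$ of order $k$. Let $h$ be an integer with $2\le h\le k$ such that each of the remaining permutations $\pi_{n+1},\dots,\pi_m$ has order at most $h-1$, and let $\omega=t_1\pi_1+\dots+t_n\pi_n$. Then $$C(\omega)\,\mathbf{b}^k_h=(0,\dots,0)^T\quad\text{and}\quad (\mathbf{b}^k_h)^T\,C(\omega)=(0,\dots,0).$$
   Context: $[k]=\{1,\dots,k\}$; a $k$-permutation is a bijection $\pi:[k]\to[k]$, $|\pi|=k$. Its permutation matrix $A_\pi\in\mathbb{R}^{k\times k}$ has $(A_\pi)_{i,j}=1$ if $\pi(i)=j$, else $0$. For a formal real linear combination $\omega=\sum_i t_i\pi_i$ of permutations of equal order, its cover matrix is $C(\omega)=\sum_i t_iA_{\pi_i}$. The gradient polynomial of a $k$-permutation $\pi$ is $P_\pi(\alpha,\beta)=k!\sum_{m\in[k]}\left(\frac{k-m}{1-\alpha}-\frac{m-1}{\alpha}\right)\left(\frac{k-\pi(m)}{1-\beta}-\frac{\pi(m)-1}{\beta}\right)\frac{\alpha^{m-1}(1-\alpha)^{k-m}\beta^{\pi(m)-1}(1-\beta)^{k-\pi(m)}}{(m-1)!(k-m)!(\pi(m)-1)!(k-\pi(m))!}$, a polynomial in $\alpha,\beta$. For $a\in[k]$, $\mathbf{b}^k_a\in\mathbb{R}^k$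 is the vector with $i$-th entry $(-1)^{i-1}\binom{a-1}{i-1}$ for $1\le i\le a$ and $0$ for $i>a$. -}

module Defs where

open import Level using (0ℓ)
open import Data.Nat as ℕ using (ℕ; zero; suc; _∸_; _<ᵇ_; _⊔_)
open import Data.Nat.Combinatorics using (_C_)
open import Data.Nat.Base using (_!)
open import Data.Fin as Fin using (Fin; toℕ)
open import Data.Fin.Permutation using (Permutation′; _⟨$⟩ʳ_)
open import Data.Bool using (if_then_else_)
open import Data.Product using (∃; _×_)
open import Data.Sum using (_⊎_)
open import Relation.Nullary using (¬_; yes; no)
open import Relation.Binary using (Rel; IsStrictTotalOrder)
open import Algebra.Bundles using (CommutativeRing)

-- An axiomatisation of the real numbers: a complete ordered field.
-- The multiplicative inverse is made total by the convention 0⁻¹ = 0.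
record RealField : Set₁ where
  field
    commRing : CommutativeRing 0ℓ 0ℓ
  open CommutativeRing commRing public
  field
    _⁻¹        : Carrier → Carrier
    ⁻¹-inverse : ∀ x → ¬ (x ≈ 0#) → x * (x ⁻¹) ≈ 1#
    ⁻¹-zero    : ∀ x → x ≈ 0# → x ⁻¹ ≈ 0#
    _<ᵣ_        : Rel Carrier 0ℓ
    <-isStrictTotalOrder : IsStrictTotalOrder _≈_ _<ᵣ_
    0<1        : 0# <ᵣ 1#
    +-mono-<   : ∀ x y z → x <ᵣ y → (x + z) <ᵣ (y + z)
    *-pos      : ∀ x y → 0# <ᵣ x → 0# <ᵣ y → 0# <ᵣ (x * y)
  _≤ᵣ_ : Rel Carrier 0ℓ
  x ≤ᵣ y = (x <ᵣ y) ⊎ (x ≈ y)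
  field
    sup : (S : Carrier → Set) → ∃ S → ∃ (λ b → ∀ x → S x → x ≤ᵣ b) →
          ∃ (λ s → (∀ x → S x → x ≤ᵣ s) × (∀ b → (∀ x → S x → x ≤ᵣ b) → s ≤ᵣ b))

module WithReals (ℝ : RealField) where
  open RealField ℝ

  fromℕ : ℕ → Carrier
  fromℕ zero    = 0#
  fromℕ (suc n) = 1# + fromℕ n

  pow : Carrier → ℕ → Carrier
  pow x zero    = 1#
  pow x (suc n) = x * pow x n

  Σ : (n : ℕ) → (Fin n → Carrier) → Carrier
  Σ zero    f = 0#
  Σ (suc n) f = f Fin.zero + Σ n (λ i → f (Fin.suc i))

  -- Gradient polynomial P_π(α,β), evaluated at α, β (meaningful for α, β ∉ {0,1}).
  -- Summation index j : Fin k stands for m = toℕ j + 1, and π(m) - 1 = toℕ (π j).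
  P : {k : ℕ} → Permutation′ k → Carrier → Carrier → Carrier
  P {k} π α β = fromℕ (k !) * Σ k term
    where
    term : Fin k → Carrier
    term j =
      let m-1  = toℕ j
          k-m  = k ∸ suc (toℕ j)
          πm-1 = toℕ (π ⟨$⟩ʳ j)
          k-πm = k ∸ suc (toℕ (π ⟨$⟩ʳ j))
      in ((fromℕ k-m * ((1# - α) ⁻¹)) - (fromℕ m-1 * (α ⁻¹)))
       * ((fromℕ k-πm * ((1# - β) ⁻¹)) - (fromℕ πm-1 * (β ⁻¹)))
       * (pow α m-1 * pow (1# - α) k-m * pow β πm-1 * pow (1# - β) k-πm)
       * ((fromℕ (m-1 !) * fromℕ (k-m !) * fromℕ (πm-1 !) * fromℕ (k-πm !)) ⁻¹)

  permMat : {k : ℕ} → Permutation′ k → Fin k → Fin k → Carrier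
  permMat π r c with π ⟨$⟩ʳ r Fin.≟ c
  ... | yes _ = 1#
  ... | no  _ = 0#

  cover : {k : ℕ} (n : ℕ) → (Fin n → Carrier) → (Fin n → Permutation′ k) → Fin k → Fin k → Carrier
  cover n t π r c = Σ n (λ i → t i * permMat (π i) r c)

  -- the vector b^k_a; index j : Fin k stands for i = toℕ j + 1
  bvec : (k a : ℕ) → Fin k → Carrier
  bvec k a j = if toℕ j <ᵇ a then pow (- 1#) (toℕ j) * fromℕ ((a ∸ 1) C toℕ j) else 0#

maxℕ : (n : ℕ) → (Fin n → ℕ) → ℕ
maxℕ zero    f = 0
maxℕ (suc n) f = f Fin.zero ⊔ maxℕ n (λ i → f (Fin.suc i))

module Submission where

-- Write ∂ₘ(x) = −d/dx [x^(m−1) (1 − x)^(k−m) / ((m − 1)! (k − m)!)], a polynomial of degree k − 2;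
-- then P_π(α, β) = k! Σ_m ∂ₘ(α) ∂_{π(m)}(β). A permutation of order at most h − 1 only
-- contributes powers β^i with i < h − 2, and a polynomial vanishing at the nodes 2, 4, 8, … is zero,
-- so comparing coefficients of β^(h−2) gives Σ_m ∂ₘ(α) g_m = 0 for all α, where
-- g_m = Σ_i t_i γ_{π_i(m)} and γ_c is the β^(h−2)-coefficient of ∂_c. The sum Σ_m ∂ₘ g_m
-- telescopes to Σ_s (g_s − g_{s+1}) times the Bernstein basis of degree k − 2, so g is constant;
-- Σ_m g_m = 0 because Σ_c γ_c = 0, hence g = 0. Finally b^k_h is a multiple of γ and
-- (C(ω) b)_row = Σ_i t_i b_{π_i(row)}; the column statement is the row statement for the inverse
-- permutations, since P_{π⁻¹}(α, β) = P_π(β, α).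

open import Defs
open import Data.Nat using (ℕ; _≤_; _∸_)
open import Data.Fin using (Fin; _↑ˡ_; _↑ʳ_)
open import Data.Fin.Permutation using (Permutation′)
open import Data.Product using (_×_)
open import Relation.Nullary using (¬_)
open import Relation.Binary.PropositionalEquality using (_≡_; _≢_; subst)

open import Data.Nat as ℕ using (zero; suc; _<_; z≤n; s≤s; _!)
import Data.Nat.Properties as ℕₚ
open import Data.Nat.Combinatorics using (_C_; nCk+nC[k+1]≡[n+1]C[k+1]; k>n⇒nCk≡0; nCn≡1)
import Data.Fin as Fin
open import Data.Fin using (toℕ)
import Data.Fin.Properties as Finₚ
open import Data.Fin.Permutation using (_⟨$⟩ʳ_; flip; inverseʳ; inverseˡ)
open import Data.Bool using (true; false; T)
open import Data.Unit using (tt)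
open import Data.Empty using (⊥-elim)
open import Data.Product using (_,_)
open import Relation.Nullary using (yes; no)
open import Relation.Binary.Definitions using (tri<; tri≈; tri>)
import Relation.Binary.PropositionalEquality as ≡
open import Relation.Binary using (IsStrictTotalOrder)
open import Algebra.Bundles using (CommutativeRing)
open import Data.Maybe using (Maybe; just; nothing)

module Binomial where
  open import Data.Nat
  open import Data.Nat.Properties
  open import Data.Nat.Combinatorics using (k![n∸k]!∣n!)
  open import Data.Nat.Combinatorics.Specification using (nCk≡n!/k![n-k]!)
  open import Data.Nat.DivMod using (m/n*n≡m)
  open import Data.Nat.Solver using (module +-*-Solver)
  open +-*-Solver
  open ≡.≡-Reasoning

  nCk*[k!*[n∸k]!]≡n! : ∀ {n k} → k ≤ n → (n C k) * (k ! * (n ∸ k) !) ≡ n !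
  nCk*[k!*[n∸k]!]≡n! {n} {k} k≤n =
    ≡.trans (≡.cong (_* (k ! * (n ∸ k) !)) (nCk≡n!/k![n-k]! k≤n))
            (m/n*n≡m {{k !* (n ∸ k) !≢0}} (k![n∸k]!∣n! k≤n))

  [1+n]*nCk≡[1+k]*[1+n]C[1+k] : ∀ n k → k ≤ n → suc n * (n C k) ≡ suc k * (suc n C suc k)
  [1+n]*nCk≡[1+k]*[1+n]C[1+k] n k k≤n =
    *-cancelʳ-≡ _ _ (k ! * (n ∸ k) !) {{k !* (n ∸ k) !≢0}} (begin
      suc n * (n C k) * (k ! * (n ∸ k) !)   ≡⟨ *-assoc (suc n) (n C k) _ ⟩
      suc n * ((n C k) * (k ! * (n ∸ k) !)) ≡⟨ ≡.cong (suc n *_) (nCk*[k!*[n∸k]!]≡n! k≤n) ⟩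
      suc n !                               ≡⟨ ≡.sym (nCk*[k!*[n∸k]!]≡n! (s≤s k≤n)) ⟩
      (suc n C suc k) * ((suc k * k !) * (n ∸ k) !)
        ≡⟨ solve 4 (λ c s f g → c :* ((s :* f) :* g) := s :* c :* (f :* g)) ≡.refl
                   (suc n C suc k) (suc k) (k !) ((n ∸ k) !) ⟩
      suc k * (suc n C suc k) * (k ! * (n ∸ k) !) ∎)

  [1+a]*aCe+j*[1+a]C[1+e]≡[1+d]*[1+a]C[1+e] : ∀ {a e j d} → e ≤ a → d ≡ j + e →
    suc a * (a C e) + j * (suc a C suc e) ≡ suc d * (suc a C suc e)
  [1+a]*aCe+j*[1+a]C[1+e]≡[1+d]*[1+a]C[1+e] {a} {e} {j} e≤a ≡.refl = begin
    suc a * (a C e) + j * C′     ≡⟨ ≡.cong (_+ j * C′) ([1+n]*nCk≡[1+k]*[1+n]C[1+k] a e e≤a) ⟩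
    suc e * C′ + j * C′          ≡⟨ ≡.sym (*-distribʳ-+ C′ (suc e) j) ⟩
    (suc e + j) * C′             ≡⟨ ≡.cong (λ x → suc x * C′) (+-comm e j) ⟩
    suc (j + e) * C′ ∎
    where C′ = suc a C suc e

  [1+d]*[1+n∸j]C[1+d∸j]*[d!*[n∸d]!]≡[1+d]Cj*[j!*[1+n∸j]!] : ∀ j d n → j ≤ d → d ≤ n →
    suc d * (suc (n ∸ j) C suc (d ∸ j)) * (d ! * (n ∸ d) !) ≡ (suc d C j) * (j ! * (suc (n ∸ j)) !)
  [1+d]*[1+n∸j]C[1+d∸j]*[d!*[n∸d]!]≡[1+d]Cj*[j!*[1+n∸j]!] j d n j≤d d≤n =
    *-cancelʳ-≡ _ _ (e !) {{e !≢0}} (begin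
      suc d * (a C e) * (d ! * (n ∸ d) !) * e !
        ≡⟨ solve 5 (λ s c f g h → s :* c :* (f :* g) :* h := (s :* f) :* (c :* (h :* g))) ≡.refl
                   (suc d) (a C e) (d !) ((n ∸ d) !) (e !) ⟩
      (suc d * d !) * ((a C e) * (e ! * (n ∸ d) !))
        ≡⟨ ≡.cong (λ x → (suc d * d !) * ((a C e) * (e ! * x !))) (≡.sym a∸e≡n∸d) ⟩
      (suc d * d !) * ((a C e) * (e ! * (a ∸ e) !))   ≡⟨ ≡.cong ((suc d * d !) *_) (nCk*[k!*[n∸k]!]≡n! e≤a) ⟩
      suc d ! * a !
        ≡⟨ ≡.cong (_* a !) (≡.sym (nCk*[k!*[n∸k]!]≡n! (m≤n⇒m≤1+n j≤d))) ⟩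
      (suc d C j) * (j ! * (suc d ∸ j) !) * a !
        ≡⟨ ≡.cong (λ x → (suc d C j) * (j ! * x !) * a !) (+-∸-assoc 1 j≤d) ⟩
      (suc d C j) * (j ! * e !) * a !
        ≡⟨ solve 4 (λ c f g h → c :* (f :* g) :* h := c :* (f :* h) :* g) ≡.refl (suc d C j) (j !) (e !) (a !) ⟩
      (suc d C j) * (j ! * a !) * e ! ∎)
    where
    a = suc (n ∸ j)
    e = suc (d ∸ j)
    e≤a : e ≤ a
    e≤a = s≤s (∸-monoˡ-≤ j d≤n)
    a∸e≡n∸d : a ∸ e ≡ n ∸ d
    a∸e≡n∸d = ≡.trans (∸-+-assoc n j (d ∸ j)) (≡.cong (n ∸_) (m+[n∸m]≡n j≤d))

open Binomial

module IntegerCoefficientSolver {c ℓ} (R : CommutativeRing c ℓ) where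
  open CommutativeRing R
  open import Relation.Binary.Reasoning.Setoid setoid
  import Data.Integer as ℤ
  import Data.Integer.Properties as ℤₚ
  import Data.Sign as Sign
  open import Algebra.Properties.Ring ring using (-1*x≈-x)
  open import Algebra.Properties.Group +-group using (ε⁻¹≈ε; ⁻¹-involutive)
  open import Algebra.Properties.AbelianGroup +-abelianGroup using (⁻¹-∙-comm)
  open import Algebra.Properties.CommutativeSemigroup +-commutativeSemigroup using () renaming (interchange to +-interchange)
  open import Algebra.Properties.CommutativeSemigroup *-commutativeSemigroup using () renaming (interchange to *-interchange)
  open import Algebra.Solver.Ring.AlmostCommutativeRing
    using (_-Raw-AlmostCommutative⟶_; fromCommutativeRing)

  ⟦_⟧ℕ : ℕ → Carrier
  ⟦ zero  ⟧ℕ = 0#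
  ⟦ suc n ⟧ℕ = 1# + ⟦ n ⟧ℕ

  ⟦_⟧ : ℤ.ℤ → Carrier
  ⟦ ℤ.+ n    ⟧ = ⟦ n ⟧ℕ
  ⟦ ℤ.-[1+ n ] ⟧ = - ⟦ suc n ⟧ℕ

  ⟦_⟧ₛ : Sign.Sign → Carrier
  ⟦ Sign.+ ⟧ₛ = 1#
  ⟦ Sign.- ⟧ₛ = - 1#

  ⟦⟧ℕ-+ : ∀ m n → ⟦ m ℕ.+ n ⟧ℕ ≈ ⟦ m ⟧ℕ + ⟦ n ⟧ℕ
  ⟦⟧ℕ-+ zero    n = sym (+-identityˡ _)
  ⟦⟧ℕ-+ (suc m) n = trans (+-congˡ (⟦⟧ℕ-+ m n)) (sym (+-assoc _ _ _))

  ⟦⟧ℕ-* : ∀ m n → ⟦ m ℕ.* n ⟧ℕ ≈ ⟦ m ⟧ℕ * ⟦ n ⟧ℕ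
  ⟦⟧ℕ-* zero    n = sym (zeroˡ _)
  ⟦⟧ℕ-* (suc m) n = begin
    ⟦ n ℕ.+ m ℕ.* n ⟧ℕ             ≈⟨ ⟦⟧ℕ-+ n (m ℕ.* n) ⟩
    ⟦ n ⟧ℕ + ⟦ m ℕ.* n ⟧ℕ          ≈⟨ +-cong (sym (*-identityˡ _)) (⟦⟧ℕ-* m n) ⟩
    1# * ⟦ n ⟧ℕ + ⟦ m ⟧ℕ * ⟦ n ⟧ℕ  ≈⟨ sym (distribʳ _ _ _) ⟩
    (1# + ⟦ m ⟧ℕ) * ⟦ n ⟧ℕ ∎

  ⟦⟧-⊖ : ∀ m n → ⟦ m ℤ.⊖ n ⟧ ≈ ⟦ m ⟧ℕ - ⟦ n ⟧ℕ
  ⟦⟧-⊖ zero    zero    = sym (-‿inverseʳ 0#)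
  ⟦⟧-⊖ zero    (suc n) = sym (+-identityˡ _)
  ⟦⟧-⊖ (suc m) zero    = sym (trans (+-congˡ ε⁻¹≈ε) (+-identityʳ _))
  ⟦⟧-⊖ (suc m) (suc n) = begin
    ⟦ suc m ℤ.⊖ suc n ⟧               ≡⟨ ≡.cong ⟦_⟧ (ℤₚ.[1+m]⊖[1+n]≡m⊖n m n) ⟩
    ⟦ m ℤ.⊖ n ⟧                       ≈⟨ ⟦⟧-⊖ m n ⟩
    ⟦ m ⟧ℕ - ⟦ n ⟧ℕ                   ≈⟨ sym (trans (+-congʳ (-‿inverseʳ 1#)) (+-identityˡ _)) ⟩
    (1# - 1#) + (⟦ m ⟧ℕ - ⟦ n ⟧ℕ)      ≈⟨ +-interchange 1# (- 1#) ⟦ m ⟧ℕ (- ⟦ n ⟧ℕ) ⟩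
    (1# + ⟦ m ⟧ℕ) + (- 1# - ⟦ n ⟧ℕ)    ≈⟨ +-congˡ (⁻¹-∙-comm 1# ⟦ n ⟧ℕ) ⟩
    (1# + ⟦ m ⟧ℕ) - (1# + ⟦ n ⟧ℕ) ∎

  ⟦⟧-◃ : ∀ s n → ⟦ s ℤ.◃ n ⟧ ≈ ⟦ s ⟧ₛ * ⟦ n ⟧ℕ
  ⟦⟧-◃ s        zero    = sym (zeroʳ _)
  ⟦⟧-◃ Sign.+   (suc n) = sym (*-identityˡ _)
  ⟦⟧-◃ Sign.-   (suc n) = sym (-1*x≈-x _)

  ⟦⟧-sign : ∀ i → ⟦ i ⟧ ≈ ⟦ ℤ.sign i ⟧ₛ * ⟦ ℤ.∣ i ∣ ⟧ℕ
  ⟦⟧-sign (ℤ.+ n)    = sym (*-identityˡ _)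
  ⟦⟧-sign ℤ.-[1+ n ] = sym (-1*x≈-x _)

  ⟦⟧ₛ-* : ∀ s t → ⟦ s Sign.* t ⟧ₛ ≈ ⟦ s ⟧ₛ * ⟦ t ⟧ₛ
  ⟦⟧ₛ-* Sign.+ t      = sym (*-identityˡ _)
  ⟦⟧ₛ-* Sign.- Sign.+ = sym (*-identityʳ _)
  ⟦⟧ₛ-* Sign.- Sign.- = sym (trans (-1*x≈-x (- 1#)) (⁻¹-involutive 1#))

  ⟦⟧-* : ∀ i j → ⟦ i ℤ.* j ⟧ ≈ ⟦ i ⟧ * ⟦ j ⟧
  ⟦⟧-* i j = begin
    ⟦ i ℤ.* j ⟧                ≈⟨ ⟦⟧-◃ (ℤ.sign i Sign.* ℤ.sign j) (ℤ.∣ i ∣ ℕ.* ℤ.∣ j ∣) ⟩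
    ⟦ ℤ.sign i Sign.* ℤ.sign j ⟧ₛ * ⟦ ℤ.∣ i ∣ ℕ.* ℤ.∣ j ∣ ⟧ℕ
                               ≈⟨ *-cong (⟦⟧ₛ-* (ℤ.sign i) (ℤ.sign j)) (⟦⟧ℕ-* ℤ.∣ i ∣ ℤ.∣ j ∣) ⟩
    (si * sj) * (ai * aj)      ≈⟨ *-interchange si sj ai aj ⟩
    (si * ai) * (sj * aj)      ≈⟨ sym (*-cong (⟦⟧-sign i) (⟦⟧-sign j)) ⟩
    ⟦ i ⟧ * ⟦ j ⟧ ∎
    where
    si = ⟦ ℤ.sign i ⟧ₛ
    sj = ⟦ ℤ.sign j ⟧ₛ
    ai = ⟦ ℤ.∣ i ∣ ⟧ℕ
    aj = ⟦ ℤ.∣ j ∣ ⟧ℕ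

  ⟦⟧-+ : ∀ i j → ⟦ i ℤ.+ j ⟧ ≈ ⟦ i ⟧ + ⟦ j ⟧
  ⟦⟧-+ (ℤ.+ m)    (ℤ.+ n)    = ⟦⟧ℕ-+ m n
  ⟦⟧-+ (ℤ.+ m)    ℤ.-[1+ n ] = ⟦⟧-⊖ m (suc n)
  ⟦⟧-+ ℤ.-[1+ m ] (ℤ.+ n)    = trans (⟦⟧-⊖ n (suc m)) (+-comm _ _)
  ⟦⟧-+ ℤ.-[1+ m ] ℤ.-[1+ n ] = begin
    - ⟦ suc (suc (m ℕ.+ n)) ⟧ℕ        ≡⟨ ≡.cong (λ k → - ⟦ suc k ⟧ℕ) (≡.sym (ℕₚ.+-suc m n)) ⟩
    - ⟦ suc m ℕ.+ suc n ⟧ℕ            ≈⟨ -‿cong (⟦⟧ℕ-+ (suc m) (suc n)) ⟩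
    - (⟦ suc m ⟧ℕ + ⟦ suc n ⟧ℕ)       ≈⟨ sym (⁻¹-∙-comm _ _) ⟩
    - ⟦ suc m ⟧ℕ + - ⟦ suc n ⟧ℕ ∎

  ⟦⟧-‿ : ∀ i → ⟦ ℤ.- i ⟧ ≈ - ⟦ i ⟧
  ⟦⟧-‿ ℤ.-[1+ n ]   = sym (⁻¹-involutive _)
  ⟦⟧-‿ (ℤ.+ zero)   = sym ε⁻¹≈ε
  ⟦⟧-‿ (ℤ.+ suc n)  = refl

  ℤ-morphism : CommutativeRing.rawRing ℤₚ.+-*-commutativeRing -Raw-AlmostCommutative⟶ fromCommutativeRing R
  ℤ-morphism = record
    { ⟦_⟧ = ⟦_⟧ ; +-homo = ⟦⟧-+ ; *-homo = ⟦⟧-* ; -‿homo = ⟦⟧-‿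
    ; 0-homo = refl ; 1-homo = +-identityʳ 1# }

  ℤ-weakly-decidable : ∀ i j → Maybe (⟦ i ⟧ ≈ ⟦ j ⟧)
  ℤ-weakly-decidable i j with i ℤₚ.≟ j
  ... | yes i≡j = just (reflexive (≡.cong ⟦_⟧ i≡j))
  ... | no  _   = nothing

  open import Algebra.Solver.Ring _ (fromCommutativeRing R) ℤ-morphism ℤ-weakly-decidable public
    using (solve; _:=_; _:+_; _:*_; _:-_; :-_)

module GradientPolynomials (ℝ : RealField) where
  open RealField ℝ
  open WithReals ℝ
  open import Relation.Binary.Reasoning.Setoid setoid
  open IntegerCoefficientSolver commRing
  open import Algebra.Properties.Ring ring using (-1*x≈-x; -0#≈0#)
  open import Algebra.Properties.Group +-group
    using (x∙y⁻¹≈ε⇒x≈y; x≈y⇒x∙y⁻¹≈ε; ∙-cancelˡ; //-rightDividesʳ; ε⁻¹≈ε; ⁻¹-involutive)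
  open import Algebra.Properties.CommutativeMonoid.Sum +-commutativeMonoid using (sum; ∑-permute)
  open import Algebra.Properties.CommutativeSemigroup *-commutativeSemigroup
    using (x∙yz≈y∙xz) renaming (interchange to *-interchange)
  open import Algebra.Properties.CommutativeSemigroup +-commutativeSemigroup using () renaming (interchange to +-interchange)
  module < = IsStrictTotalOrder <-isStrictTotalOrder

  0≉1 : 0# ≉ 1#
  0≉1 0≈1 = <.irrefl 0≈1 0<1

  >0⇒≉0 : ∀ {x} → 0# <ᵣ x → x ≉ 0#
  >0⇒≉0 0<x x≈0 = <.irrefl (sym x≈0) 0<x

  +-monoʳ-< : ∀ z {x y} → x <ᵣ y → (z + x) <ᵣ (z + y)
  +-monoʳ-< z {x} {y} x<y = <.<-respˡ-≈ (+-comm x z) (<.<-respʳ-≈ (+-comm y z) (+-mono-< x y z x<y))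

  1+>0 : ∀ {x} → 0# <ᵣ x → 0# <ᵣ (1# + x)
  1+>0 0<x = <.trans 0<1 (<.<-respˡ-≈ (+-identityʳ 1#) (+-monoʳ-< 1# 0<x))

  x*x⁻¹≈1 : ∀ {x} → x ≉ 0# → x * x ⁻¹ ≈ 1#
  x*x⁻¹≈1 {x} = ⁻¹-inverse x

  x⁻¹*x≈1 : ∀ {x} → x ≉ 0# → x ⁻¹ * x ≈ 1#
  x⁻¹*x≈1 x≉0 = trans (*-comm _ _) (x*x⁻¹≈1 x≉0)

  x*y≈0⇒y≈0 : ∀ {x y} → x ≉ 0# → x * y ≈ 0# → y ≈ 0#
  x*y≈0⇒y≈0 {x} {y} x≉0 xy≈0 = begin
    y              ≈⟨ sym (*-identityˡ y) ⟩
    1# * y         ≈⟨ *-congʳ (sym (x⁻¹*x≈1 x≉0)) ⟩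
    x ⁻¹ * x * y   ≈⟨ *-assoc _ _ _ ⟩
    x ⁻¹ * (x * y) ≈⟨ *-congˡ xy≈0 ⟩
    x ⁻¹ * 0#      ≈⟨ zeroʳ _ ⟩
    0# ∎

  *-cancelʳ : ∀ {x y z} → z ≉ 0# → x * z ≈ y * z → x ≈ y
  *-cancelʳ {x} {y} {z} z≉0 xz≈yz = begin
    x                ≈⟨ sym (*-identityʳ x) ⟩
    x * 1#           ≈⟨ *-congˡ (sym (x*x⁻¹≈1 z≉0)) ⟩
    x * (z * z ⁻¹)   ≈⟨ sym (*-assoc _ _ _) ⟩
    x * z * z ⁻¹     ≈⟨ *-congʳ xz≈yz ⟩
    y * z * z ⁻¹     ≈⟨ *-assoc _ _ _ ⟩
    y * (z * z ⁻¹)   ≈⟨ *-congˡ (x*x⁻¹≈1 z≉0) ⟩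
    y * 1#           ≈⟨ *-identityʳ y ⟩
    y ∎

  1-x≉0 : ∀ {x} → x ≉ 1# → 1# - x ≉ 0#
  1-x≉0 {x} x≉1 1-x≈0 = x≉1 (sym (x∙y⁻¹≈ε⇒x≈y 1# x 1-x≈0))

  *-≉0 : ∀ {x y} → x ≉ 0# → y ≉ 0# → x * y ≉ 0#
  *-≉0 x≉0 y≉0 xy≈0 = y≉0 (x*y≈0⇒y≈0 x≉0 xy≈0)

  ⁻¹-unique : ∀ {x v} → x * v ≈ 1# → v ≈ x ⁻¹
  ⁻¹-unique {x} {v} xv≈1 = *-cancelʳ x≉0 (begin
    v * x        ≈⟨ trans (*-comm v x) xv≈1 ⟩
    1#           ≈⟨ sym (x⁻¹*x≈1 x≉0) ⟩
    x ⁻¹ * x ∎)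
    where
    x≉0 : x ≉ 0#
    x≉0 x≈0 = 0≉1 (trans (sym (trans (*-congʳ x≈0) (zeroˡ v))) xv≈1)

  ⁻¹-≉0 : ∀ {x} → x ≉ 0# → x ⁻¹ ≉ 0#
  ⁻¹-≉0 {x} x≉0 x⁻¹≈0 = 0≉1 (trans (sym (trans (*-congˡ x⁻¹≈0) (zeroʳ x))) (x*x⁻¹≈1 x≉0))

  ⁻¹-cong : ∀ {x y} → x ≈ y → x ⁻¹ ≈ y ⁻¹
  ⁻¹-cong {x} {y} x≈y with x <.≟ 0#
  ... | yes x≈0 = trans (⁻¹-zero x x≈0) (sym (⁻¹-zero y (trans (sym x≈y) x≈0)))
  ... | no  x≉0 = ⁻¹-unique (trans (*-congʳ (sym x≈y)) (x*x⁻¹≈1 x≉0))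

  ⁻¹-distrib-* : ∀ {x y} → x ≉ 0# → y ≉ 0# → (x * y) ⁻¹ ≈ x ⁻¹ * y ⁻¹
  ⁻¹-distrib-* {x} {y} x≉0 y≉0 = sym (⁻¹-unique (begin
    x * y * (x ⁻¹ * y ⁻¹)   ≈⟨ *-interchange x y (x ⁻¹) (y ⁻¹) ⟩
    x * x ⁻¹ * (y * y ⁻¹)   ≈⟨ *-cong (x*x⁻¹≈1 x≉0) (x*x⁻¹≈1 y≉0) ⟩
    1# * 1#                 ≈⟨ *-identityˡ 1# ⟩
    1# ∎))

  fromℕ-+ : ∀ m n → fromℕ (m ℕ.+ n) ≈ fromℕ m + fromℕ n
  fromℕ-+ zero    n = sym (+-identityˡ _)
  fromℕ-+ (suc m) n = trans (+-congˡ (fromℕ-+ m n)) (sym (+-assoc _ _ _))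

  fromℕ-* : ∀ m n → fromℕ (m ℕ.* n) ≈ fromℕ m * fromℕ n
  fromℕ-* zero    n = sym (zeroˡ _)
  fromℕ-* (suc m) n = begin
    fromℕ (n ℕ.+ m ℕ.* n)            ≈⟨ fromℕ-+ n (m ℕ.* n) ⟩
    fromℕ n + fromℕ (m ℕ.* n)        ≈⟨ +-congˡ (fromℕ-* m n) ⟩
    fromℕ n + fromℕ m * fromℕ n      ≈⟨ +-congʳ (sym (*-identityˡ _)) ⟩
    1# * fromℕ n + fromℕ m * fromℕ n ≈⟨ sym (distribʳ _ _ _) ⟩
    (1# + fromℕ m) * fromℕ n ∎

  fromℕ-suc>0 : ∀ n → 0# <ᵣ fromℕ (suc n)
  fromℕ-suc>0 zero    = <.<-respʳ-≈ (sym (+-identityʳ 1#)) 0<1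
  fromℕ-suc>0 (suc n) = 1+>0 (fromℕ-suc>0 n)

  fromℕ-suc≉0 : ∀ n → fromℕ (suc n) ≉ 0#
  fromℕ-suc≉0 n = >0⇒≉0 (fromℕ-suc>0 n)

  fact : ℕ → Carrier
  fact n = fromℕ (n !)

  fact≉0 : ∀ n → fact n ≉ 0#
  fact≉0 n with n ! | ℕₚ.1≤n! n
  ... | suc m | _ = fromℕ-suc≉0 m

  fact*fact≉0 : ∀ j a → fact j * fact a ≉ 0#
  fact*fact≉0 j a = *-≉0 (fact≉0 j) (fact≉0 a)

  Σ-cong : ∀ n {f g : Fin n → Carrier} → (∀ i → f i ≈ g i) → Σ n f ≈ Σ n g
  Σ-cong zero    f≈g = refl
  Σ-cong (suc n) f≈g = +-cong (f≈g Fin.zero) (Σ-cong n (λ i → f≈g (Fin.suc i)))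

  Σ-≈0 : ∀ n {f : Fin n → Carrier} → (∀ i → f i ≈ 0#) → Σ n f ≈ 0#
  Σ-≈0 zero    f≈0 = refl
  Σ-≈0 (suc n) f≈0 = trans (+-cong (f≈0 Fin.zero) (Σ-≈0 n (λ i → f≈0 (Fin.suc i)))) (+-identityˡ 0#)

  Σ-+ : ∀ n (f g : Fin n → Carrier) → Σ n (λ i → f i + g i) ≈ Σ n f + Σ n g
  Σ-+ zero    f g = sym (+-identityˡ 0#)
  Σ-+ (suc n) f g = trans (+-congˡ (Σ-+ n (λ i → f (Fin.suc i)) (λ i → g (Fin.suc i))))
    (+-interchange _ _ _ _)

  Σ-- : ∀ n (f g : Fin n → Carrier) → Σ n (λ i → f i - g i) ≈ Σ n f - Σ n g
  Σ-- zero    f g = sym (-‿inverseʳ 0#)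
  Σ-- (suc n) f g = trans (+-congˡ (Σ-- n (λ i → f (Fin.suc i)) (λ i → g (Fin.suc i))))
    (solve 4 (λ a b c d → ((a :- b) :+ (c :- d)) := ((a :+ c) :- (b :+ d))) refl _ _ _ _)

  Σ-*ˡ : ∀ n c (f : Fin n → Carrier) → Σ n (λ i → c * f i) ≈ c * Σ n f
  Σ-*ˡ zero    c f = sym (zeroʳ c)
  Σ-*ˡ (suc n) c f = trans (+-congˡ (Σ-*ˡ n c (λ i → f (Fin.suc i)))) (sym (distribˡ c _ _))

  Σ-comm : ∀ m n (f : Fin m → Fin n → Carrier) →
           Σ m (λ i → Σ n (λ j → f i j)) ≈ Σ n (λ j → Σ m (λ i → f i j))
  Σ-comm zero    n f = sym (Σ-≈0 n (λ _ → refl))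
  Σ-comm (suc m) n f = trans (+-congˡ (Σ-comm m n (λ i → f (Fin.suc i))))
                             (sym (Σ-+ n (f Fin.zero) (λ j → Σ m (λ i → f (Fin.suc i) j))))

  Σ-splitAt : ∀ n r (f : Fin (n ℕ.+ r) → Carrier) →
              Σ (n ℕ.+ r) f ≈ Σ n (λ j → f (j ↑ˡ r)) + Σ r (λ j → f (n ↑ʳ j))
  Σ-splitAt zero    r f = sym (+-identityˡ _)
  Σ-splitAt (suc n) r f = trans (+-congˡ (Σ-splitAt n r (λ i → f (Fin.suc i)))) (sym (+-assoc _ _ _))

  Σ-init-last : ∀ n (f : Fin (suc n) → Carrier) →
                Σ (suc n) f ≈ Σ n (λ i → f (Fin.inject₁ i)) + f (Fin.fromℕ n)
  Σ-init-last zero    f = +-comm _ _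
  Σ-init-last (suc n) f = trans (+-congˡ (Σ-init-last n (λ i → f (Fin.suc i)))) (sym (+-assoc _ _ _))

  Σ-const : ∀ n c → Σ n (λ _ → c) ≈ fromℕ n * c
  Σ-const zero    c = sym (zeroˡ c)
  Σ-const (suc n) c = begin
    c + Σ n (λ _ → c)     ≈⟨ +-cong (sym (*-identityˡ c)) (Σ-const n c) ⟩
    1# * c + fromℕ n * c  ≈⟨ sym (distribʳ c 1# (fromℕ n)) ⟩
    (1# + fromℕ n) * c ∎

  Σ≈sum : ∀ n (f : Fin n → Carrier) → Σ n f ≈ sum f
  Σ≈sum zero    f = refl
  Σ≈sum (suc n) f = +-congˡ (Σ≈sum n (λ i → f (Fin.suc i)))

  Σ-permute : ∀ n (π : Permutation′ n) (f : Fin n → Carrier) → Σ n (λ m → f (π ⟨$⟩ʳ m)) ≈ Σ n f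
  Σ-permute n π f = trans (Σ≈sum n _) (trans (sym (∑-permute f π)) (sym (Σ≈sum n f)))

  Σ-select : ∀ n (a : Fin n) (D f : Fin n → Carrier) →
             (∀ c → a ≡ c → D c ≈ 1#) → (∀ c → a ≢ c → D c ≈ 0#) → Σ n (λ c → D c * f c) ≈ f a
  Σ-select (suc n) Fin.zero D f D≈1 D≈0 = begin
    D Fin.zero * f Fin.zero + Σ n (λ c → D (Fin.suc c) * f (Fin.suc c))
      ≈⟨ +-cong (trans (*-congʳ (D≈1 Fin.zero ≡.refl)) (*-identityˡ _))
                (Σ-≈0 n (λ c → trans (*-congʳ (D≈0 (Fin.suc c) (λ ()))) (zeroˡ _))) ⟩
    f Fin.zero + 0#  ≈⟨ +-identityʳ _ ⟩
    f Fin.zero ∎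
  Σ-select (suc n) (Fin.suc a) D f D≈1 D≈0 = begin
    D Fin.zero * f Fin.zero + Σ n (λ c → D (Fin.suc c) * f (Fin.suc c))
      ≈⟨ +-cong (trans (*-congʳ (D≈0 Fin.zero (λ ()))) (zeroˡ _))
                (Σ-select n a (λ c → D (Fin.suc c)) (λ c → f (Fin.suc c))
                   (λ c a≡c → D≈1 (Fin.suc c) (≡.cong Fin.suc a≡c))
                   (λ c a≢c → D≈0 (Fin.suc c) (λ e → a≢c (Finₚ.suc-injective e)))) ⟩
    0# + f (Fin.suc a)  ≈⟨ +-identityˡ _ ⟩
    f (Fin.suc a) ∎

  Σ-telescope : ∀ n (X Y : Fin (suc n) → Carrier) → X (Fin.fromℕ n) ≈ 0# → Y Fin.zero ≈ 0# →
                Σ (suc n) (λ c → X c - Y c) ≈ Σ n (λ s → X (Fin.inject₁ s) - Y (Fin.suc s))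
  Σ-telescope n X Y Xₙ≈0 Y₀≈0 = begin
    Σ (suc n) (λ c → X c - Y c)   ≈⟨ Σ-- (suc n) X Y ⟩
    Σ (suc n) X - Σ (suc n) Y     ≈⟨ +-cong (Σ-init-last n X) (-‿cong (+-congʳ Y₀≈0)) ⟩
    (Σ n (λ s → X (Fin.inject₁ s)) + X (Fin.fromℕ n)) - (0# + Σ n (λ s → Y (Fin.suc s)))
      ≈⟨ +-cong (trans (+-congˡ Xₙ≈0) (+-identityʳ _)) (-‿cong (+-identityˡ _)) ⟩
    Σ n (λ s → X (Fin.inject₁ s)) - Σ n (λ s → Y (Fin.suc s))  ≈⟨ sym (Σ-- n _ _) ⟩
    Σ n (λ s → X (Fin.inject₁ s) - Y (Fin.suc s)) ∎

  pow-cong : ∀ {x y} n → x ≈ y → pow x n ≈ pow y n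
  pow-cong zero    x≈y = refl
  pow-cong (suc n) x≈y = *-cong x≈y (pow-cong n x≈y)

  pow-+ : ∀ x m n → pow x (m ℕ.+ n) ≈ pow x m * pow x n
  pow-+ x zero    n = sym (*-identityˡ _)
  pow-+ x (suc m) n = trans (*-congˡ (pow-+ x m n)) (sym (*-assoc _ _ _))

  pow-* : ∀ x y n → pow (x * y) n ≈ pow x n * pow y n
  pow-* x y zero    = sym (*-identityˡ 1#)
  pow-* x y (suc n) = trans (*-congˡ (pow-* x y n))
    (*-interchange x y (pow x n) (pow y n))

  pow-≉0 : ∀ {x} n → x ≉ 0# → pow x n ≉ 0#
  pow-≉0 zero    x≉0 = λ 1≈0 → 0≉1 (sym 1≈0)
  pow-≉0 (suc n) x≉0 = *-≉0 x≉0 (pow-≉0 n x≉0)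

  pow-‿1-suc : ∀ n → pow (- 1#) (suc n) ≈ - pow (- 1#) n
  pow-‿1-suc n = -1*x≈-x (pow (- 1#) n)

  pow-‿1-square : ∀ n → pow (- 1#) n * pow (- 1#) n ≈ 1#
  pow-‿1-square zero    = *-identityˡ 1#
  pow-‿1-square (suc n) = begin
    (- 1# * p) * (- 1# * p)   ≈⟨ *-interchange (- 1#) p (- 1#) p ⟩
    (- 1# * - 1#) * (p * p)   ≈⟨ *-cong (trans (-1*x≈-x (- 1#)) (⁻¹-involutive 1#)) (pow-‿1-square n) ⟩
    1# * 1#                   ≈⟨ *-identityˡ 1# ⟩
    1# ∎
    where p = pow (- 1#) n

  n*[x⁻¹*xⁿ]≈n*xⁿ⁻¹ : ∀ {x} n → x ≉ 0# → fromℕ n * (x ⁻¹ * pow x n) ≈ fromℕ n * pow x (n ∸ 1)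
  n*[x⁻¹*xⁿ]≈n*xⁿ⁻¹ zero    x≉0 = trans (zeroˡ _) (sym (zeroˡ _))
  n*[x⁻¹*xⁿ]≈n*xⁿ⁻¹ (suc n) x≉0 =
    *-congˡ (trans (sym (*-assoc _ _ _)) (trans (*-congʳ (x⁻¹*x≈1 x≉0)) (*-identityˡ _)))

  two : Carrier
  two = 1# + 1#

  node : ℕ → Carrier
  node i = pow two (suc i)

  x<two*x : ∀ {x} → 0# <ᵣ x → x <ᵣ (two * x)
  x<two*x {x} 0<x = <.<-respˡ-≈ (+-identityʳ x) (<.<-respʳ-≈ (sym two*x≈x+x) (+-monoʳ-< x 0<x))
    where
    two*x≈x+x : two * x ≈ x + x
    two*x≈x+x = trans (distribʳ x 1# 1#) (+-cong (*-identityˡ x) (*-identityˡ x))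

  two^n>0 : ∀ n → 0# <ᵣ pow two n
  two^n>0 zero    = 0<1
  two^n>0 (suc n) = <.trans (two^n>0 n) (x<two*x (two^n>0 n))

  node>1 : ∀ i → 1# <ᵣ node i
  node>1 zero    = <.<-respʳ-≈ (sym (*-identityʳ two)) (<.<-respˡ-≈ (+-identityʳ 1#) (+-monoʳ-< 1# 0<1))
  node>1 (suc i) = <.trans (node>1 i) (x<two*x (two^n>0 (suc i)))

  node≉0 : ∀ i → node i ≉ 0#
  node≉0 i = >0⇒≉0 (two^n>0 (suc i))

  node≉1 : ∀ i → node i ≉ 1#
  node≉1 i node≈1 = <.irrefl (sym node≈1) (node>1 i)

  node-1≉0 : ∀ i → node i - 1# ≉ 0#
  node-1≉0 i node-1≈0 = node≉1 i (x∙y⁻¹≈ε⇒x≈y (node i) 1# node-1≈0)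

  -- If p vanishes at all nodes y then so does (p (two * y) − p y) / y, a polynomial of lower
  -- degree whose coefficients are c (s + 1) * (2 ^ (s + 1) − 1).
  vanishes-at-nodes⇒≈0 : ∀ D (c : Fin D → Carrier) →
    (∀ i → Σ D (λ s → c s * pow (node i) (toℕ s)) ≈ 0#) → ∀ s → c s ≈ 0#
  vanishes-at-nodes⇒≈0 (suc D) c p≈0 = c≈0
    where
    R : Carrier → Carrier
    R y = Σ D (λ s → c (Fin.suc s) * (y * pow y (toℕ s)))

    c′ : Fin D → Carrier
    c′ s = c (Fin.suc s) * (node (toℕ s) - 1#)

    term : ∀ y a t → y * (a * (two * pow two t - 1#) * pow y t) ≈
                     a * ((two * y) * pow (two * y) t) - a * (y * pow y t)
    term y a t = begin
      y * (a * (two * pow two t - 1#) * pow y t)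
        ≈⟨ solve 6 (λ y a w p q o → (y :* (a :* (w :* p :- o) :* q)) := (a :* ((w :* y) :* (p :* q)) :- a :* (y :* (o :* q))))
                   refl y a two (pow two t) (pow y t) 1# ⟩
      a * ((two * y) * (pow two t * pow y t)) - a * (y * (1# * pow y t))
        ≈⟨ +-cong (*-congˡ (*-congˡ (sym (pow-* two y t)))) (-‿cong (*-congˡ (*-congˡ (*-identityˡ _)))) ⟩
      a * ((two * y) * pow (two * y) t) - a * (y * pow y t) ∎

    q≈0 : ∀ i → Σ D (λ s → c′ s * pow (node i) (toℕ s)) ≈ 0#
    q≈0 i = x*y≈0⇒y≈0 (node≉0 i) (begin
      y * Σ D (λ s → c′ s * pow y (toℕ s))    ≈⟨ sym (Σ-*ˡ D y _) ⟩
      Σ D (λ s → y * (c′ s * pow y (toℕ s)))  ≈⟨ Σ-cong D (λ s → term y (c (Fin.suc s)) (toℕ s)) ⟩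
      Σ D (λ s → c (Fin.suc s) * ((two * y) * pow (two * y) (toℕ s)) - c (Fin.suc s) * (y * pow y (toℕ s)))
        ≈⟨ Σ-- D _ _ ⟩
      R (two * y) - R y
        ≈⟨ x≈y⇒x∙y⁻¹≈ε (∙-cancelˡ (c Fin.zero * 1#) _ _ (trans (p≈0 (suc i)) (sym (p≈0 i)))) ⟩
      0# ∎)
      where y = node i

    c₊≈0 : ∀ s → c (Fin.suc s) ≈ 0#
    c₊≈0 s = x*y≈0⇒y≈0 (node-1≉0 (toℕ s)) (trans (*-comm _ _) (vanishes-at-nodes⇒≈0 D c′ q≈0 s))

    c≈0 : ∀ s → c s ≈ 0#
    c≈0 (Fin.suc s) = c₊≈0 s
    c≈0 Fin.zero    = begin
      c Fin.zero                      ≈⟨ sym (*-identityʳ _) ⟩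
      c Fin.zero * 1#                 ≈⟨ sym (+-identityʳ _) ⟩
      c Fin.zero * 1# + 0#            ≈⟨ +-congˡ (sym (Σ-≈0 D (λ s → trans (*-congʳ (c₊≈0 s)) (zeroˡ _)))) ⟩
      c Fin.zero * 1# + R (node 0)    ≈⟨ p≈0 0 ⟩
      0# ∎

  eval : ℕ → (ℕ → Carrier) → Carrier → Carrier
  eval N c x = Σ N (λ s → c (toℕ s) * pow x (toℕ s))

  eval-≈0⇒coeff≈0 : ∀ N (c : ℕ → Carrier) → (∀ y → y ≉ 0# → y ≉ 1# → eval N c y ≈ 0#) →
                    ∀ {i} → i < N → c i ≈ 0#
  eval-≈0⇒coeff≈0 N c p≈0 i<N =
    trans (reflexive (≡.cong c (≡.sym (Finₚ.toℕ-fromℕ< i<N))))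
          (vanishes-at-nodes⇒≈0 N (λ s → c (toℕ s)) (λ i → p≈0 (node i) (node≉0 i) (node≉1 i)) (Fin.fromℕ< i<N))

  eval-cong : ∀ N x {c c′ : ℕ → Carrier} → (∀ i → c i ≈ c′ i) → eval N c x ≈ eval N c′ x
  eval-cong N x c≈c′ = Σ-cong N (λ s → *-congʳ (c≈c′ (toℕ s)))

  eval-+ : ∀ N x (c c′ : ℕ → Carrier) → eval N (λ i → c i + c′ i) x ≈ eval N c x + eval N c′ x
  eval-+ N x c c′ = trans (Σ-cong N (λ s → distribʳ _ _ _)) (Σ-+ N _ _)

  eval-- : ∀ N x (c c′ : ℕ → Carrier) → eval N (λ i → c i - c′ i) x ≈ eval N c x - eval N c′ x
  eval-- N x c c′ = trans (Σ-cong N (λ s → solve 3 (λ a b p → ((a :- b) :* p) := (a :* p :- b :* p)) refl _ _ _)) (Σ-- N _ _)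

  eval-*ˡ : ∀ N x a (c : ℕ → Carrier) → eval N (λ i → a * c i) x ≈ a * eval N c x
  eval-*ˡ N x a c = trans (Σ-cong N (λ s → *-assoc _ _ _)) (Σ-*ˡ N a _)

  eval-Σ : ∀ N x M (c : Fin M → ℕ → Carrier) → eval N (λ i → Σ M (λ j → c j i)) x ≈ Σ M (λ j → eval N (c j) x)
  eval-Σ N x M c = begin
    Σ N (λ s → Σ M (λ j → c j (toℕ s)) * pow x (toℕ s))
      ≈⟨ Σ-cong N (λ s → trans (*-comm _ _) (trans (sym (Σ-*ˡ M _ _)) (Σ-cong M (λ j → *-comm _ _)))) ⟩
    Σ N (λ s → Σ M (λ j → c j (toℕ s) * pow x (toℕ s)))  ≈⟨ Σ-comm N M _ ⟩
    Σ M (λ j → eval N (c j) x) ∎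

  eval-suc : ∀ N x (c : ℕ → Carrier) → c 0 ≈ 0# → eval (suc N) c x ≈ x * eval N (λ i → c (suc i)) x
  eval-suc N x c c₀≈0 = begin
    c 0 * 1# + Σ N (λ s → c (suc (toℕ s)) * (x * pow x (toℕ s)))
      ≈⟨ +-cong (trans (*-congʳ c₀≈0) (zeroˡ _))
                (Σ-cong N (λ s → solve 3 (λ a b p → (a :* (b :* p)) := (b :* (a :* p))) refl _ _ _)) ⟩
    0# + Σ N (λ s → x * (c (suc (toℕ s)) * pow x (toℕ s)))  ≈⟨ +-identityˡ _ ⟩
    Σ N (λ s → x * (c (suc (toℕ s)) * pow x (toℕ s)))       ≈⟨ Σ-*ˡ N x _ ⟩
    x * eval N (λ i → c (suc i)) x ∎

  bern : Carrier → ℕ → ℕ → Carrier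
  bern x j a = pow x j * pow (1# - x) a

  bernCoeff : ℕ → ℕ → ℕ → Carrier
  bernCoeff i       zero    a = pow (- 1#) i * fromℕ (a C i)
  bernCoeff zero    (suc j) a = 0#
  bernCoeff (suc i) (suc j) a = bernCoeff i j a

  bernCoeff-pascal : ∀ i j a → bernCoeff i j (suc a) ≈ bernCoeff i j a - bernCoeff i (suc j) a
  bernCoeff-pascal zero    zero    a = sym (trans (+-congˡ -0#≈0#) (+-identityʳ _))
  bernCoeff-pascal (suc i) zero    a = begin
    pow (- 1#) (suc i) * fromℕ (suc a C suc i)
      ≡⟨ ≡.cong (λ n → pow (- 1#) (suc i) * fromℕ n) (≡.sym (nCk+nC[k+1]≡[n+1]C[k+1] a i)) ⟩
    pow (- 1#) (suc i) * fromℕ (a C i ℕ.+ a C suc i)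
      ≈⟨ *-cong (pow-‿1-suc i) (fromℕ-+ (a C i) (a C suc i)) ⟩
    - p * (fromℕ (a C i) + fromℕ (a C suc i))
      ≈⟨ solve 3 (λ p u v → :- p :* (u :+ v) := :- p :* v :- p :* u) refl p _ _ ⟩
    - p * fromℕ (a C suc i) - p * fromℕ (a C i)
      ≈⟨ +-congʳ (*-congʳ (sym (pow-‿1-suc i))) ⟩
    pow (- 1#) (suc i) * fromℕ (a C suc i) - p * fromℕ (a C i) ∎
    where p = pow (- 1#) i
  bernCoeff-pascal zero    (suc j) a = sym (trans (+-congˡ -0#≈0#) (+-identityʳ _))
  bernCoeff-pascal (suc i) (suc j) a = bernCoeff-pascal i j a

  bernCoeff-low : ∀ {i j} a → i < j → bernCoeff i j a ≈ 0#
  bernCoeff-low {zero}  {suc j} a _           = refl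
  bernCoeff-low {suc i} {suc j} a (s≤s i<j) = bernCoeff-low a i<j

  bernCoeff-high : ∀ {i} j a → j ℕ.+ a < i → bernCoeff i j a ≈ 0#
  bernCoeff-high {i}     zero    a a<i         = trans (*-congˡ (reflexive (≡.cong fromℕ (k>n⇒nCk≡0 a<i)))) (zeroʳ _)
  bernCoeff-high {suc i} (suc j) a (s≤s j+a<i) = bernCoeff-high j a j+a<i

  bernCoeff-≥ : ∀ {i j} a → j ≤ i → bernCoeff i j a ≈ pow (- 1#) (i ∸ j) * fromℕ (a C (i ∸ j))
  bernCoeff-≥ {i}     {zero}  a _         = refl
  bernCoeff-≥ {suc i} {suc j} a (s≤s j≤i) = bernCoeff-≥ a j≤i

  eval-bernCoeff-0 : ∀ j N x → j < N → eval N (λ i → bernCoeff i j 0) x ≈ bern x j 0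
  eval-bernCoeff-0 zero    (suc N) x _ = begin
    (1# * (1# + 0#)) * 1# + Σ N (λ s → (pow (- 1#) (suc (toℕ s)) * 0#) * (x * pow x (toℕ s)))
      ≈⟨ +-cong (*-congʳ (trans (*-identityˡ _) (+-identityʳ 1#)))
                (Σ-≈0 N (λ s → trans (*-congʳ (zeroʳ _)) (zeroˡ _))) ⟩
    1# * 1# + 0#  ≈⟨ +-identityʳ _ ⟩
    1# * 1# ∎
  eval-bernCoeff-0 (suc j) (suc N) x (s≤s j<N) = begin
    eval (suc N) (λ i → bernCoeff i (suc j) 0) x    ≈⟨ eval-suc N x (λ i → bernCoeff i (suc j) 0) refl ⟩
    x * eval N (λ i → bernCoeff i j 0) x           ≈⟨ *-congˡ (eval-bernCoeff-0 j N x j<N) ⟩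
    x * bern x j 0                                 ≈⟨ sym (*-assoc _ _ _) ⟩
    bern x (suc j) 0 ∎

  eval-bernCoeff : ∀ j a N x → j ℕ.+ a < N → eval N (λ i → bernCoeff i j a) x ≈ bern x j a
  eval-bernCoeff j zero    N x j+0<N = eval-bernCoeff-0 j N x (≡.subst (_< N) (ℕₚ.+-identityʳ j) j+0<N)
  eval-bernCoeff j (suc a) N x j+1+a<N = begin
    eval N (λ i → bernCoeff i j (suc a)) x
      ≈⟨ eval-cong N x (λ i → bernCoeff-pascal i j a) ⟩
    eval N (λ i → bernCoeff i j a - bernCoeff i (suc j) a) x
      ≈⟨ eval-- N x (λ i → bernCoeff i j a) (λ i → bernCoeff i (suc j) a) ⟩
    eval N (λ i → bernCoeff i j a) x - eval N (λ i → bernCoeff i (suc j) a) x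
      ≈⟨ +-cong (eval-bernCoeff j a N x j+a<N) (-‿cong (eval-bernCoeff (suc j) a N x 1+j+a<N)) ⟩
    pow x j * pow (1# - x) a - (x * pow x j) * pow (1# - x) a
      ≈⟨ +-congʳ (*-congˡ (sym (*-identityˡ _))) ⟩
    pow x j * (1# * pow (1# - x) a) - (x * pow x j) * pow (1# - x) a
      ≈⟨ solve 4 (λ p q x o → p :* (o :* q) :- (x :* p) :* q := p :* ((o :- x) :* q)) refl (pow x j) (pow (1# - x) a) x 1# ⟩
    bern x j (suc a) ∎
    where
    1+j+a<N : suc j ℕ.+ a < N
    1+j+a<N = ≡.subst (_< N) (ℕₚ.+-suc j a) j+1+a<N
    j+a<N : j ℕ.+ a < N
    j+a<N = ℕₚ.<-trans (ℕₚ.n<1+n _) 1+j+a<N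

  -- ∂ (bern x) j a = − d/dx (x ^ j (1 − x) ^ a / (j! a!)); it is stated for any B so that it also
  -- applies to the coefficient sequences bernCoeff i. The truncated a ∸ 1 and j ∸ 1 are harmless:
  -- they only occur multiplied by a and j respectively.
  ∂ : (ℕ → ℕ → Carrier) → ℕ → ℕ → Carrier
  ∂ B j a = (fact j * fact a) ⁻¹ * (fromℕ a * B j (a ∸ 1) - fromℕ j * B (j ∸ 1) a)

  ∂ₘ : (K : ℕ) → (ℕ → ℕ → Carrier) → Fin K → Carrier
  ∂ₘ K B m = ∂ B (toℕ m) (K ∸ suc (toℕ m))

  P-factor≈∂ : ∀ {x} → x ≉ 0# → x ≉ 1# → ∀ j a →
    (fromℕ a * (1# - x) ⁻¹ - fromℕ j * x ⁻¹) * bern x j a * (fact j * fact a) ⁻¹ ≈ ∂ (bern x) j a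
  P-factor≈∂ {x} x≉0 x≉1 j a = begin
    (fromℕ a * w ⁻¹ - fromℕ j * x ⁻¹) * (X * W) * I
      ≈⟨ solve 7 (λ u w′ v x′ X W I → (u :* w′ :- v :* x′) :* (X :* W) :* I := I :* (u :* (w′ :* W) :* X :- v :* (x′ :* X) :* W))
               refl (fromℕ a) (w ⁻¹) (fromℕ j) (x ⁻¹) X W I ⟩
    I * (fromℕ a * (w ⁻¹ * W) * X - fromℕ j * (x ⁻¹ * X) * W)
      ≈⟨ *-congˡ (+-cong (*-congʳ (n*[x⁻¹*xⁿ]≈n*xⁿ⁻¹ a (1-x≉0 x≉1))) (-‿cong (*-congʳ (n*[x⁻¹*xⁿ]≈n*xⁿ⁻¹ j x≉0)))) ⟩
    I * (fromℕ a * pow w (a ∸ 1) * X - fromℕ j * pow x (j ∸ 1) * W)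
      ≈⟨ solve 7 (λ u W′ X v X′ W I → I :* (u :* W′ :* X :- v :* X′ :* W) := I :* (u :* (X :* W′) :- v :* (X′ :* W)))
               refl (fromℕ a) (pow w (a ∸ 1)) X (fromℕ j) (pow x (j ∸ 1)) W I ⟩
    ∂ (bern x) j a ∎
    where
    w = 1# - x
    X = pow x j
    W = pow w a
    I = (fact j * fact a) ⁻¹

  P≈Σ∂∂ : ∀ {K} (π : Permutation′ K) {α β} → α ≉ 0# → α ≉ 1# → β ≉ 0# → β ≉ 1# →
          P π α β ≈ fromℕ (K !) * Σ K (λ m → ∂ₘ K (bern α) m * ∂ₘ K (bern β) (π ⟨$⟩ʳ m))
  P≈Σ∂∂ {K} π α≉0 α≉1 β≉0 β≉1 = *-congˡ (Σ-cong K (λ m →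
    trans (regroup (fact*fact≉0 (j m) (a m)) (fact*fact≉0 (j (π ⟨$⟩ʳ m)) (a (π ⟨$⟩ʳ m))))
          (*-cong (P-factor≈∂ α≉0 α≉1 (j m) (a m)) (P-factor≈∂ β≉0 β≉1 (j (π ⟨$⟩ʳ m)) (a (π ⟨$⟩ʳ m))))))
    where
    j a : Fin K → ℕ
    j m = toℕ m
    a m = K ∸ suc (toℕ m)

    regroup : ∀ {A B p q r s f g h k} → f * g ≉ 0# → h * k ≉ 0# →
      A * B * (p * q * r * s) * (f * g * h * k) ⁻¹ ≈ A * (p * q) * (f * g) ⁻¹ * (B * (r * s) * (h * k) ⁻¹)
    regroup {A} {B} {p} {q} {r} {s} {f} {g} {h} {k} fg≉0 hk≉0 = begin
      A * B * (p * q * r * s) * (f * g * h * k) ⁻¹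
        ≈⟨ *-congˡ (trans (⁻¹-cong (*-assoc (f * g) h k)) (⁻¹-distrib-* fg≉0 hk≉0)) ⟩
      A * B * (p * q * r * s) * ((f * g) ⁻¹ * (h * k) ⁻¹)
        ≈⟨ solve 8 (λ A B p q r s u v → A :* B :* (p :* q :* r :* s) :* (u :* v) := A :* (p :* q) :* u :* (B :* (r :* s) :* v))
                 refl A B p q r s ((f * g) ⁻¹) ((h * k) ⁻¹) ⟩
      A * (p * q) * (f * g) ⁻¹ * (B * (r * s) * (h * k) ⁻¹) ∎

  ∂-≈0 : ∀ B j a → fromℕ a * B j (a ∸ 1) ≈ 0# → fromℕ j * B (j ∸ 1) a ≈ 0# → ∂ B j a ≈ 0#
  ∂-≈0 B j a left≈0 right≈0 =
    trans (*-congˡ (trans (+-cong left≈0 (-‿cong right≈0)) (trans (+-identityˡ _) -0#≈0#))) (zeroʳ _)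

  ∂-bernCoeff-high : ∀ {i} j a → j ℕ.+ a ≤ i → ∂ (bernCoeff i) j a ≈ 0#
  ∂-bernCoeff-high {i} j a j+a≤i = ∂-≈0 (bernCoeff i) j a (left a j+a≤i) (right j j+a≤i)
    where
    left : ∀ a′ → j ℕ.+ a′ ≤ i → fromℕ a′ * bernCoeff i j (a′ ∸ 1) ≈ 0#
    left zero     _ = zeroˡ _
    left (suc a′) j+1+a′≤i =
      trans (*-congˡ (bernCoeff-high j a′ (≡.subst (_≤ i) (ℕₚ.+-suc j a′) j+1+a′≤i))) (zeroʳ _)
    right : ∀ j′ → j′ ℕ.+ a ≤ i → fromℕ j′ * bernCoeff i (j′ ∸ 1) a ≈ 0#
    right zero     _ = zeroˡ _
    right (suc j′) j′+a<i = trans (*-congˡ (bernCoeff-high j′ a j′+a<i)) (zeroʳ _)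

  ∂-bernCoeff-low : ∀ {i j} a → suc i < j → ∂ (bernCoeff i) j a ≈ 0#
  ∂-bernCoeff-low {i} {suc j} a (s≤s i<j) = ∂-≈0 (bernCoeff i) (suc j) a
    (trans (*-congˡ (bernCoeff-low (a ∸ 1) (ℕₚ.m<n⇒m<1+n i<j))) (zeroʳ _))
    (trans (*-congˡ (bernCoeff-low a i<j)) (zeroʳ _))

  eval-∂ : ∀ N j a x → j ℕ.+ a ≤ N → eval N (λ i → ∂ (bernCoeff i) j a) x ≈ ∂ (bern x) j a
  eval-∂ N j a x j+a≤N = begin
    eval N (λ i → I * (fromℕ a * bernCoeff i j (a ∸ 1) - fromℕ j * bernCoeff i (j ∸ 1) a)) x
      ≈⟨ eval-*ˡ N x I (λ i → fromℕ a * bernCoeff i j (a ∸ 1) - fromℕ j * bernCoeff i (j ∸ 1) a) ⟩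
    I * eval N (λ i → fromℕ a * bernCoeff i j (a ∸ 1) - fromℕ j * bernCoeff i (j ∸ 1) a) x
      ≈⟨ *-congˡ (eval-- N x (λ i → fromℕ a * bernCoeff i j (a ∸ 1)) (λ i → fromℕ j * bernCoeff i (j ∸ 1) a)) ⟩
    I * (eval N (λ i → fromℕ a * bernCoeff i j (a ∸ 1)) x - eval N (λ i → fromℕ j * bernCoeff i (j ∸ 1) a) x)
      ≈⟨ *-congˡ (+-cong (trans (eval-*ˡ N x (fromℕ a) (λ i → bernCoeff i j (a ∸ 1))) (left a j+a≤N))
                         (-‿cong (trans (eval-*ˡ N x (fromℕ j) (λ i → bernCoeff i (j ∸ 1) a)) (right j j+a≤N)))) ⟩
    ∂ (bern x) j a ∎
    where
    I = (fact j * fact a) ⁻¹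
    left : ∀ a′ → j ℕ.+ a′ ≤ N → fromℕ a′ * eval N (λ i → bernCoeff i j (a′ ∸ 1)) x ≈ fromℕ a′ * bern x j (a′ ∸ 1)
    left zero     _ = trans (zeroˡ _) (sym (zeroˡ _))
    left (suc a′) j+1+a′≤N = *-congˡ (eval-bernCoeff j a′ N x (≡.subst (_≤ N) (ℕₚ.+-suc j a′) j+1+a′≤N))
    right : ∀ j′ → j′ ℕ.+ a ≤ N → fromℕ j′ * eval N (λ i → bernCoeff i (j′ ∸ 1) a) x ≈ fromℕ j′ * bern x (j′ ∸ 1) a
    right zero     _ = trans (zeroˡ _) (sym (zeroˡ _))
    right (suc j′) j′+a<N = *-congˡ (eval-bernCoeff j′ a N x j′+a<N)

  Pcoeff : ∀ {K} → Permutation′ K → Carrier → ℕ → Carrier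
  Pcoeff {K} π x i = fromℕ (K !) * Σ K (λ m → ∂ₘ K (bern x) m * ∂ₘ K (bernCoeff i) (π ⟨$⟩ʳ m))

  toℕ+[K∸1+toℕ]≤N : ∀ {K N} (m : Fin K) → K ≤ suc N → toℕ m ℕ.+ (K ∸ suc (toℕ m)) ≤ N
  toℕ+[K∸1+toℕ]≤N {K} {N} m K≤1+N =
    ℕₚ.≤-pred (≡.subst (_≤ suc N) (≡.sym (ℕₚ.m+[n∸m]≡n (Finₚ.toℕ<n m))) K≤1+N)

  P≈eval-Pcoeff : ∀ N {K} (π : Permutation′ K) {x y} → K ≤ suc N →
                  x ≉ 0# → x ≉ 1# → y ≉ 0# → y ≉ 1# → P π x y ≈ eval N (Pcoeff π x) y
  P≈eval-Pcoeff N {K} π {x} {y} K≤1+N x≉0 x≉1 y≉0 y≉1 = begin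
    P π x y
      ≈⟨ P≈Σ∂∂ π x≉0 x≉1 y≉0 y≉1 ⟩
    fromℕ (K !) * Σ K (λ m → ∂ₘ K (bern x) m * ∂ₘ K (bern y) (π ⟨$⟩ʳ m))
      ≈⟨ *-congˡ (Σ-cong K (λ m → *-congˡ (sym (eval-∂ N (toℕ (π ⟨$⟩ʳ m)) (K ∸ suc (toℕ (π ⟨$⟩ʳ m))) y
                                                         (toℕ+[K∸1+toℕ]≤N (π ⟨$⟩ʳ m) K≤1+N))))) ⟩
    fromℕ (K !) * Σ K (λ m → ∂ₘ K (bern x) m * eval N (λ i → ∂ₘ K (bernCoeff i) (π ⟨$⟩ʳ m)) y)
      ≈⟨ *-congˡ (Σ-cong K (λ m → sym (eval-*ˡ N y (∂ₘ K (bern x) m) (λ i → ∂ₘ K (bernCoeff i) (π ⟨$⟩ʳ m))))) ⟩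
    fromℕ (K !) * Σ K (λ m → eval N (λ i → ∂ₘ K (bern x) m * ∂ₘ K (bernCoeff i) (π ⟨$⟩ʳ m)) y)
      ≈⟨ *-congˡ (sym (eval-Σ N y K (λ m i → ∂ₘ K (bern x) m * ∂ₘ K (bernCoeff i) (π ⟨$⟩ʳ m)))) ⟩
    fromℕ (K !) * eval N (λ i → Σ K (λ m → ∂ₘ K (bern x) m * ∂ₘ K (bernCoeff i) (π ⟨$⟩ʳ m))) y
      ≈⟨ sym (eval-*ˡ N y (fromℕ (K !)) (λ i → Σ K (λ m → ∂ₘ K (bern x) m * ∂ₘ K (bernCoeff i) (π ⟨$⟩ʳ m)))) ⟩
    eval N (Pcoeff π x) y ∎

  Pcoeff-high : ∀ {K} (π : Permutation′ K) x {i} → K ≤ suc i → Pcoeff π x i ≈ 0#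
  Pcoeff-high {K} π x K≤1+i = trans (*-congˡ (Σ-≈0 K (λ m → trans (*-congˡ
    (∂-bernCoeff-high (toℕ (π ⟨$⟩ʳ m)) (K ∸ suc (toℕ (π ⟨$⟩ʳ m))) (toℕ+[K∸1+toℕ]≤N (π ⟨$⟩ʳ m) K≤1+i))) (zeroʳ _)))) (zeroʳ _)

  Σ-t*P≈eval : ∀ N {n} {ord : Fin n → ℕ} (σ : ∀ j → Permutation′ (ord j)) (t : Fin n → Carrier) {x y} →
    (∀ j → ord j ≤ suc N) → x ≉ 0# → x ≉ 1# → y ≉ 0# → y ≉ 1# →
    Σ n (λ j → t j * P (σ j) x y) ≈ eval N (λ i → Σ n (λ j → t j * Pcoeff (σ j) x i)) y
  Σ-t*P≈eval N {n} σ t {x} {y} ord≤1+N x≉0 x≉1 y≉0 y≉1 = begin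
    Σ n (λ j → t j * P (σ j) x y)
      ≈⟨ Σ-cong n (λ j → *-congˡ (P≈eval-Pcoeff N (σ j) (ord≤1+N j) x≉0 x≉1 y≉0 y≉1)) ⟩
    Σ n (λ j → t j * eval N (Pcoeff (σ j) x) y)
      ≈⟨ Σ-cong n (λ j → sym (eval-*ˡ N y (t j) (Pcoeff (σ j) x))) ⟩
    Σ n (λ j → eval N (λ i → t j * Pcoeff (σ j) x i) y)
      ≈⟨ sym (eval-Σ N y n (λ j i → t j * Pcoeff (σ j) x i)) ⟩
    eval N (λ i → Σ n (λ j → t j * Pcoeff (σ j) x i)) y ∎

  Σ-t*Pcoeff≈ : ∀ {K n} (σ : Fin n → Permutation′ K) (t : Fin n → Carrier) x i →
    Σ n (λ j → t j * Pcoeff (σ j) x i) ≈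
    fromℕ (K !) * Σ K (λ m → ∂ₘ K (bern x) m * Σ n (λ j → t j * ∂ₘ K (bernCoeff i) (σ j ⟨$⟩ʳ m)))
  Σ-t*Pcoeff≈ {K} {n} σ t x i = begin
    Σ n (λ j → t j * (F * Σ K (λ m → a m * b j m)))
      ≈⟨ Σ-cong n (λ j → trans (x∙yz≈y∙xz (t j) F _) (*-congˡ (sym (Σ-*ˡ K (t j) (λ m → a m * b j m))))) ⟩
    Σ n (λ j → F * Σ K (λ m → t j * (a m * b j m)))
      ≈⟨ Σ-*ˡ n F _ ⟩
    F * Σ n (λ j → Σ K (λ m → t j * (a m * b j m)))
      ≈⟨ *-congˡ (Σ-comm n K (λ j m → t j * (a m * b j m))) ⟩
    F * Σ K (λ m → Σ n (λ j → t j * (a m * b j m)))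
      ≈⟨ *-congˡ (Σ-cong K (λ m → trans (Σ-cong n (λ j → x∙yz≈y∙xz (t j) (a m) (b j m))) (Σ-*ˡ n (a m) _))) ⟩
    F * Σ K (λ m → a m * Σ n (λ j → t j * b j m)) ∎
    where
    F = fromℕ (K !)
    a : Fin K → Carrier
    a = ∂ₘ K (bern x)
    b : Fin n → Fin K → Carrier
    b j m = ∂ₘ K (bernCoeff i) (σ j ⟨$⟩ʳ m)

  P-flip : ∀ {K} (π : Permutation′ K) {α β} → α ≉ 0# → α ≉ 1# → β ≉ 0# → β ≉ 1# →
           P (flip π) α β ≈ P π β α
  P-flip {K} π {α} {β} α≉0 α≉1 β≉0 β≉1 = begin
    P (flip π) α β
      ≈⟨ P≈Σ∂∂ (flip π) α≉0 α≉1 β≉0 β≉1 ⟩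
    fromℕ (K !) * Σ K (λ m → ∂ₘ K (bern α) m * ∂ₘ K (bern β) (flip π ⟨$⟩ʳ m))
      ≈⟨ *-congˡ (Σ-cong K (λ m → trans (*-comm _ _) (*-congˡ (reflexive (≡.cong (∂ₘ K (bern α)) (≡.sym (inverseʳ π))))))) ⟩
    fromℕ (K !) * Σ K (λ m → ∂ₘ K (bern β) (flip π ⟨$⟩ʳ m) * ∂ₘ K (bern α) (π ⟨$⟩ʳ (flip π ⟨$⟩ʳ m)))
      ≈⟨ *-congˡ (Σ-permute K (flip π) (λ m → ∂ₘ K (bern β) m * ∂ₘ K (bern α) (π ⟨$⟩ʳ m))) ⟩
    fromℕ (K !) * Σ K (λ m → ∂ₘ K (bern β) m * ∂ₘ K (bern α) (π ⟨$⟩ʳ m))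
      ≈⟨ sym (P≈Σ∂∂ π β≉0 β≉1 α≉0 α≉1) ⟩
    P π β α ∎

  P-subst : ∀ {K K′} (K≡K′ : K ≡ K′) (π : Permutation′ K) {α β} →
            P (subst Permutation′ K≡K′ π) α β ≈ P π α β
  P-subst ≡.refl π = refl

  fact-suc : ∀ n → fact (suc n) ≈ fromℕ (suc n) * fact n
  fact-suc n = fromℕ-* (suc n) (n !)

  [1+a]*[j!*[1+a]!]⁻¹≈[j!*a!]⁻¹ : ∀ j a → fromℕ (suc a) * (fact j * fact (suc a)) ⁻¹ ≈ (fact j * fact a) ⁻¹
  [1+a]*[j!*[1+a]!]⁻¹≈[j!*a!]⁻¹ j a = ⁻¹-unique (begin
    fact j * fact a * (fromℕ (suc a) * I)
      ≈⟨ solve 4 (λ f g s i → f :* g :* (s :* i) := f :* (s :* g) :* i) refl (fact j) (fact a) (fromℕ (suc a)) I ⟩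
    fact j * (fromℕ (suc a) * fact a) * I  ≈⟨ *-congʳ (*-congˡ (sym (fact-suc a))) ⟩
    fact j * fact (suc a) * I              ≈⟨ x*x⁻¹≈1 (fact*fact≉0 j (suc a)) ⟩
    1# ∎)
    where I = (fact j * fact (suc a)) ⁻¹

  [1+j]*[[1+j]!*a!]⁻¹≈[j!*a!]⁻¹ : ∀ j a → fromℕ (suc j) * (fact (suc j) * fact a) ⁻¹ ≈ (fact j * fact a) ⁻¹
  [1+j]*[[1+j]!*a!]⁻¹≈[j!*a!]⁻¹ j a = ⁻¹-unique (begin
    fact j * fact a * (fromℕ (suc j) * I)
      ≈⟨ solve 4 (λ f g s i → f :* g :* (s :* i) := s :* f :* g :* i) refl (fact j) (fact a) (fromℕ (suc j)) I ⟩
    fromℕ (suc j) * fact j * fact a * I    ≈⟨ *-congʳ (*-congʳ (sym (fact-suc j))) ⟩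
    fact (suc j) * fact a * I              ≈⟨ x*x⁻¹≈1 (fact*fact≉0 (suc j) a) ⟩
    1# ∎)
    where I = (fact (suc j) * fact a) ⁻¹

  Σ-∂ₘ-telescope : ∀ n (B : ℕ → ℕ → Carrier) (g : Fin (suc (suc n)) → Carrier) →
    Σ (suc (suc n)) (λ m → ∂ₘ (suc (suc n)) B m * g m) ≈
    Σ (suc n) (λ s → (fact (toℕ s) * fact (n ∸ toℕ s)) ⁻¹ * B (toℕ s) (n ∸ toℕ s) * (g (Fin.inject₁ s) - g (Fin.suc s)))
  Σ-∂ₘ-telescope n B g = begin
    Σ (suc (suc n)) (λ m → ∂ₘ (suc (suc n)) B m * g m)   ≈⟨ Σ-cong (suc (suc n)) (λ m → split (toℕ m) (g m)) ⟩
    Σ (suc (suc n)) (λ m → X m - Y m)                     ≈⟨ Σ-telescope (suc n) X Y X-last Y-zero ⟩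
    Σ (suc n) (λ s → X (Fin.inject₁ s) - Y (Fin.suc s))   ≈⟨ Σ-cong (suc n) adjacent ⟩
    Σ (suc n) (λ s → E (toℕ s) * B (toℕ s) (n ∸ toℕ s) * (g (Fin.inject₁ s) - g (Fin.suc s))) ∎
    where
    E : ℕ → Carrier
    E t = (fact t * fact (n ∸ t)) ⁻¹
    Xc Yc : ℕ → Carrier
    Xc j = (fact j * fact (suc n ∸ j)) ⁻¹ * (fromℕ (suc n ∸ j) * B j (suc n ∸ j ∸ 1))
    Yc j = (fact j * fact (suc n ∸ j)) ⁻¹ * (fromℕ j * B (j ∸ 1) (suc n ∸ j))
    X Y : Fin (suc (suc n)) → Carrier
    X m = Xc (toℕ m) * g m
    Y m = Yc (toℕ m) * g m

    split : ∀ j c → ∂ B j (suc n ∸ j) * c ≈ Xc j * c - Yc j * c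
    split j c = solve 4 (λ i p q c → i :* (p :- q) :* c := i :* p :* c :- i :* q :* c) refl _ _ _ c

    X-last : X (Fin.fromℕ (suc n)) ≈ 0#
    X-last = trans (*-congʳ (trans (reflexive (≡.cong Xc (Finₚ.toℕ-fromℕ (suc n))))
                                   (trans (*-congˡ (trans (*-congʳ (reflexive (≡.cong fromℕ (ℕₚ.n∸n≡0 n)))) (zeroˡ _))) (zeroʳ _))))
                   (zeroˡ _)

    Y-zero : Y Fin.zero ≈ 0#
    Y-zero = trans (*-congʳ (trans (*-congˡ (zeroˡ _)) (zeroʳ _))) (zeroˡ _)

    adjacent : ∀ s → X (Fin.inject₁ s) - Y (Fin.suc s) ≈
                     E (toℕ s) * B (toℕ s) (n ∸ toℕ s) * (g (Fin.inject₁ s) - g (Fin.suc s))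
    adjacent s = begin
      Xc (toℕ (Fin.inject₁ s)) * g₁ - Yc (suc t) * g₂
        ≡⟨ ≡.cong (λ j → Xc j * g₁ - Yc (suc t) * g₂) (Finₚ.toℕ-inject₁ s) ⟩
      Xc t * g₁ - Yc (suc t) * g₂                      ≈⟨ +-cong (*-congʳ Xc≈) (-‿cong (*-congʳ Yc≈)) ⟩
      E t * b * g₁ - E t * b * g₂
        ≈⟨ solve 3 (λ e g₁ g₂ → e :* g₁ :- e :* g₂ := e :* (g₁ :- g₂)) refl (E t * b) g₁ g₂ ⟩
      E t * b * (g₁ - g₂) ∎
      where
      t = toℕ s
      b = B t (n ∸ t)
      g₁ = g (Fin.inject₁ s)
      g₂ = g (Fin.suc s)
      1+n∸t≡1+[n∸t] : suc n ∸ t ≡ suc (n ∸ t)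
      1+n∸t≡1+[n∸t] = ℕₚ.+-∸-assoc 1 (ℕₚ.≤-pred (Finₚ.toℕ<n s))
      Xc≈ : Xc t ≈ E t * b
      Xc≈ = begin
        Xc t  ≡⟨ ≡.cong (λ a → (fact t * fact a) ⁻¹ * (fromℕ a * B t (a ∸ 1))) 1+n∸t≡1+[n∸t] ⟩
        (fact t * fact (suc (n ∸ t))) ⁻¹ * (fromℕ (suc (n ∸ t)) * b)  ≈⟨ sym (*-assoc _ _ _) ⟩
        (fact t * fact (suc (n ∸ t))) ⁻¹ * fromℕ (suc (n ∸ t)) * b
          ≈⟨ *-congʳ (trans (*-comm _ _) ([1+a]*[j!*[1+a]!]⁻¹≈[j!*a!]⁻¹ t (n ∸ t))) ⟩
        E t * b ∎
      Yc≈ : Yc (suc t) ≈ E t * b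
      Yc≈ = trans (sym (*-assoc _ _ _)) (*-congʳ (trans (*-comm _ _) ([1+j]*[[1+j]!*a!]⁻¹≈[j!*a!]⁻¹ t (n ∸ t))))

  Σ-∂ₘ≈0 : ∀ n B → Σ (suc (suc n)) (∂ₘ (suc (suc n)) B) ≈ 0#
  Σ-∂ₘ≈0 n B = begin
    Σ (suc (suc n)) (∂ₘ (suc (suc n)) B)
      ≈⟨ Σ-cong (suc (suc n)) (λ m → sym (*-identityʳ (∂ₘ (suc (suc n)) B m))) ⟩
    Σ (suc (suc n)) (λ m → ∂ₘ (suc (suc n)) B m * 1#)  ≈⟨ Σ-∂ₘ-telescope n B (λ _ → 1#) ⟩
    Σ (suc n) (λ s → E s * (1# - 1#))
      ≈⟨ Σ-≈0 (suc n) (λ s → trans (*-congˡ (-‿inverseʳ 1#)) (zeroʳ (E s))) ⟩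
    0# ∎
    where
    E : Fin (suc n) → Carrier
    E s = (fact (toℕ s) * fact (n ∸ toℕ s)) ⁻¹ * B (toℕ s) (n ∸ toℕ s)

  1-y*[1+y]⁻¹≈[1+y]⁻¹ : ∀ {y} → 1# + y ≉ 0# → 1# - y * (1# + y) ⁻¹ ≈ (1# + y) ⁻¹
  1-y*[1+y]⁻¹≈[1+y]⁻¹ {y} 1+y≉0 = begin
    1# - y * z          ≈⟨ +-congʳ (sym (x*x⁻¹≈1 1+y≉0)) ⟩
    (1# + y) * z - y * z ≈⟨ +-congʳ (trans (distribʳ z 1# y) (+-congʳ (*-identityˡ z))) ⟩
    z + y * z - y * z   ≈⟨ //-rightDividesʳ (y * z) z ⟩
    z ∎
    where z = (1# + y) ⁻¹

  bern-at-y*[1+y]⁻¹ : ∀ {y} → 1# + y ≉ 0# → ∀ {s n} → s ≤ n →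
                      bern (y * (1# + y) ⁻¹) s (n ∸ s) ≈ pow ((1# + y) ⁻¹) n * pow y s
  bern-at-y*[1+y]⁻¹ {y} 1+y≉0 {s} {n} s≤n = begin
    pow (y * z) s * pow (1# - y * z) (n ∸ s)
      ≈⟨ *-cong (pow-* y z s) (pow-cong (n ∸ s) (1-y*[1+y]⁻¹≈[1+y]⁻¹ 1+y≉0)) ⟩
    pow y s * pow z s * pow z (n ∸ s)           ≈⟨ *-assoc _ _ _ ⟩
    pow y s * (pow z s * pow z (n ∸ s))         ≈⟨ *-congˡ (sym (pow-+ z s (n ∸ s))) ⟩
    pow y s * pow z (s ℕ.+ (n ∸ s))             ≡⟨ ≡.cong (λ k → pow y s * pow z k) (ℕₚ.m+[n∸m]≡n s≤n) ⟩
    pow y s * pow z n                           ≈⟨ *-comm _ _ ⟩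
    pow z n * pow y s ∎
    where z = (1# + y) ⁻¹

  -- At x = y / (1 + y) the telescoped sum is (1 + y) ^ (− n) times a polynomial in y, which
  -- therefore vanishes at every node.
  Σ∂ₘ≈0⇒adjacent≈ : ∀ n (g : Fin (suc (suc n)) → Carrier) →
    (∀ x → x ≉ 0# → x ≉ 1# → Σ (suc (suc n)) (λ m → ∂ₘ (suc (suc n)) (bern x) m * g m) ≈ 0#) →
    ∀ s → g (Fin.inject₁ s) ≈ g (Fin.suc s)
  Σ∂ₘ≈0⇒adjacent≈ n g Σ≈0 s =
    x∙y⁻¹≈ε⇒x≈y _ _ (x*y≈0⇒y≈0 (⁻¹-≉0 (fact*fact≉0 (toℕ s) (n ∸ toℕ s)))
                                (vanishes-at-nodes⇒≈0 (suc n) c vanish s))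
    where
    E : Fin (suc n) → Carrier
    E s = (fact (toℕ s) * fact (n ∸ toℕ s)) ⁻¹
    Δ : Fin (suc n) → Carrier
    Δ s = g (Fin.inject₁ s) - g (Fin.suc s)
    c : Fin (suc n) → Carrier
    c s = E s * Δ s

    vanish : ∀ i → Σ (suc n) (λ s → c s * pow (node i) (toℕ s)) ≈ 0#
    vanish i = x*y≈0⇒y≈0 (pow-≉0 n z≉0) (begin
      pow z n * Σ (suc n) (λ s → c s * pow y (toℕ s))
        ≈⟨ sym (Σ-*ˡ (suc n) (pow z n) (λ s → c s * pow y (toℕ s))) ⟩
      Σ (suc n) (λ s → pow z n * (c s * pow y (toℕ s)))   ≈⟨ Σ-cong (suc n) reorder ⟩
      Σ (suc n) (λ s → E s * bern x (toℕ s) (n ∸ toℕ s) * Δ s)  ≈⟨ sym (Σ-∂ₘ-telescope n (bern x) g) ⟩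
      Σ (suc (suc n)) (λ m → ∂ₘ (suc (suc n)) (bern x) m * g m) ≈⟨ Σ≈0 x x≉0 x≉1 ⟩
      0# ∎)
      where
      y = node i
      1+y≉0 : 1# + y ≉ 0#
      1+y≉0 = >0⇒≉0 (1+>0 (two^n>0 (suc i)))
      z = (1# + y) ⁻¹
      z≉0 : z ≉ 0#
      z≉0 = ⁻¹-≉0 1+y≉0
      x = y * z
      x≉0 : x ≉ 0#
      x≉0 = *-≉0 (node≉0 i) z≉0
      x≉1 : x ≉ 1#
      x≉1 x≈1 = z≉0 (trans (sym (1-y*[1+y]⁻¹≈[1+y]⁻¹ 1+y≉0)) (trans (+-congˡ (-‿cong x≈1)) (-‿inverseʳ 1#)))
      reorder : ∀ s → pow z n * (c s * pow y (toℕ s)) ≈ E s * bern x (toℕ s) (n ∸ toℕ s) * Δ s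
      reorder s = begin
        pow z n * (E s * Δ s * pow y (toℕ s))
          ≈⟨ solve 4 (λ w e d p → w :* (e :* d :* p) := e :* (w :* p) :* d) refl _ (E s) (Δ s) _ ⟩
        E s * (pow z n * pow y (toℕ s)) * Δ s
          ≈⟨ *-congʳ (*-congˡ (sym (bern-at-y*[1+y]⁻¹ 1+y≉0 (ℕₚ.≤-pred (Finₚ.toℕ<n s))))) ⟩
        E s * bern x (toℕ s) (n ∸ toℕ s) * Δ s ∎

  adjacent≈⇒≈zero : ∀ n (g : Fin (suc n) → Carrier) → (∀ s → g (Fin.inject₁ s) ≈ g (Fin.suc s)) →
                    ∀ m → g m ≈ g Fin.zero
  adjacent≈⇒≈zero n       g adj Fin.zero    = refl
  adjacent≈⇒≈zero (suc n) g adj (Fin.suc m) =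
    trans (sym (adj m)) (adjacent≈⇒≈zero n (λ i → g (Fin.inject₁ i)) (λ s → adj (Fin.inject₁ s)) m)

  constant-Σ≈0⇒≈0 : ∀ n (g : Fin (suc n) → Carrier) → (∀ m → g m ≈ g Fin.zero) → Σ (suc n) g ≈ 0# →
                    ∀ m → g m ≈ 0#
  constant-Σ≈0⇒≈0 n g g≈g₀ Σg≈0 m = trans (g≈g₀ m) (x*y≈0⇒y≈0 (fromℕ-suc≉0 n) (begin
    fromℕ (suc n) * g Fin.zero      ≈⟨ sym (Σ-const (suc n) _) ⟩
    Σ (suc n) (λ _ → g Fin.zero)    ≈⟨ sym (Σ-cong (suc n) g≈g₀) ⟩
    Σ (suc n) g                     ≈⟨ Σg≈0 ⟩
    0# ∎))

  VanishingCombination : ∀ {K nT r} {ord : Fin r → ℕ} →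
    (Fin nT → Carrier) → (Fin nT → Permutation′ K) → (Fin r → Carrier) → (∀ j → Permutation′ (ord j)) → Set
  VanishingCombination {nT = nT} {r} tT σT tL σL = ∀ x y → x ≉ 0# → x ≉ 1# → y ≉ 0# → y ≉ 1# →
    Σ nT (λ j → tT j * P (σT j) x y) + Σ r (λ j → tL j * P (σL j) x y) ≈ 0#

  VanishingCombination-flip : ∀ {K nT r} {ord : Fin r → ℕ}
    (tT : Fin nT → Carrier) (σT : Fin nT → Permutation′ K)
    (tL : Fin r → Carrier) (σL : ∀ j → Permutation′ (ord j)) →
    VanishingCombination tT σT tL σL →
    VanishingCombination tT (λ j → flip (σT j)) tL (λ j → flip (σL j))
  VanishingCombination-flip {nT = nT} {r} tT σT tL σL P≈0 x y x≉0 x≉1 y≉0 y≉1 = trans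
    (+-cong (Σ-cong nT (λ j → *-congˡ (P-flip (σT j) x≉0 x≉1 y≉0 y≉1)))
            (Σ-cong r (λ j → *-congˡ (P-flip (σL j) x≉0 x≉1 y≉0 y≉1))))
    (P≈0 y x y≉0 y≉1 x≉0 x≉1)

  Σ-t*∂ₘ-bernCoeff≈0 : ∀ {d n} → d ≤ n → ∀ {nT r} {ord : Fin r → ℕ}
    (tT : Fin nT → Carrier) (σT : Fin nT → Permutation′ (suc (suc n)))
    (tL : Fin r → Carrier) (σL : ∀ j → Permutation′ (ord j)) →
    (∀ j → ord j ≤ suc d) → VanishingCombination tT σT tL σL →
    ∀ m → Σ nT (λ j → tT j * ∂ₘ (suc (suc n)) (bernCoeff d) (σT j ⟨$⟩ʳ m)) ≈ 0#
  Σ-t*∂ₘ-bernCoeff≈0 {d} {n} d≤n {nT} {r} tT σT tL σL ord≤1+d P≈0 =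
    constant-Σ≈0⇒≈0 (suc n) g (adjacent≈⇒≈zero (suc n) g (Σ∂ₘ≈0⇒adjacent≈ n g Σ∂ₘ*g≈0)) Σg≈0
    where
    K = suc (suc n)
    g : Fin K → Carrier
    g m = Σ nT (λ j → tT j * ∂ₘ K (bernCoeff d) (σT j ⟨$⟩ʳ m))

    Top Low : Carrier → ℕ → Carrier
    Top x i = Σ nT (λ j → tT j * Pcoeff (σT j) x i)
    Low x i = Σ r (λ j → tL j * Pcoeff (σL j) x i)

    Top≈0 : ∀ x → x ≉ 0# → x ≉ 1# → Top x d ≈ 0#
    Top≈0 x x≉0 x≉1 = begin
      Top x d            ≈⟨ sym (+-identityʳ _) ⟩
      Top x d + 0#
        ≈⟨ +-congˡ (sym (Σ-≈0 r (λ j → trans (*-congˡ (Pcoeff-high (σL j) x (ord≤1+d j))) (zeroʳ _)))) ⟩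
      Top x d + Low x d  ≈⟨ eval-≈0⇒coeff≈0 K (λ i → Top x i + Low x i) vanish (s≤s (ℕₚ.m≤n⇒m≤1+n d≤n)) ⟩
      0# ∎
      where
      vanish : ∀ y → y ≉ 0# → y ≉ 1# → eval K (λ i → Top x i + Low x i) y ≈ 0#
      vanish y y≉0 y≉1 = trans (eval-+ K y (Top x) (Low x)) (trans
        (sym (+-cong (Σ-t*P≈eval K σT tT (λ _ → ℕₚ.n≤1+n K) x≉0 x≉1 y≉0 y≉1)
                     (Σ-t*P≈eval K σL tL (λ j → ℕₚ.≤-trans (ord≤1+d j) (s≤s (ℕₚ.m≤n⇒m≤1+n (ℕₚ.m≤n⇒m≤1+n d≤n))))
                                 x≉0 x≉1 y≉0 y≉1)))
        (P≈0 x y x≉0 x≉1 y≉0 y≉1))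

    Σ∂ₘ*g≈0 : ∀ x → x ≉ 0# → x ≉ 1# → Σ K (λ m → ∂ₘ K (bern x) m * g m) ≈ 0#
    Σ∂ₘ*g≈0 x x≉0 x≉1 = x*y≈0⇒y≈0 (fact≉0 K) (trans (sym (Σ-t*Pcoeff≈ σT tT x d)) (Top≈0 x x≉0 x≉1))

    Σg≈0 : Σ K g ≈ 0#
    Σg≈0 = begin
      Σ K g
        ≈⟨ Σ-comm K nT (λ m j → tT j * ∂ₘ K (bernCoeff d) (σT j ⟨$⟩ʳ m)) ⟩
      Σ nT (λ j → Σ K (λ m → tT j * ∂ₘ K (bernCoeff d) (σT j ⟨$⟩ʳ m)))
        ≈⟨ Σ-cong nT (λ j → Σ-*ˡ K (tT j) (λ m → ∂ₘ K (bernCoeff d) (σT j ⟨$⟩ʳ m))) ⟩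
      Σ nT (λ j → tT j * Σ K (λ m → ∂ₘ K (bernCoeff d) (σT j ⟨$⟩ʳ m)))
        ≈⟨ Σ-≈0 nT (λ j → trans (*-congˡ (trans (Σ-permute K (σT j) (∂ₘ K (bernCoeff d))) (Σ-∂ₘ≈0 n (bernCoeff d)))) (zeroʳ _)) ⟩
      0# ∎

  bvec-< : ∀ {K} h (c : Fin K) → toℕ c < h → bvec K h c ≡ pow (- 1#) (toℕ c) * fromℕ ((h ∸ 1) C toℕ c)
  bvec-< h c c<h with toℕ c ℕ.<ᵇ h | ℕₚ.<⇒<ᵇ c<h
  ... | true | _ = ≡.refl

  bvec-≥ : ∀ {K} h (c : Fin K) → h ≤ toℕ c → bvec K h c ≡ 0#
  bvec-≥ h c h≤c with toℕ c ℕ.<ᵇ h in eq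
  ... | false = ≡.refl
  ... | true  = ⊥-elim (ℕₚ.<⇒≱ (ℕₚ.<ᵇ⇒< (toℕ c) h (≡.subst T (≡.sym eq) tt)) h≤c)

  bvec-scale : ℕ → ℕ → Carrier
  bvec-scale d n = pow (- 1#) d * (fact d * fact (n ∸ d))

  bvec-scale*∂-diagonal : ∀ d n →
    bvec-scale d n * ∂ (bernCoeff d) (suc d) (n ∸ d) ≈ pow (- 1#) (suc d) * fromℕ (suc d C suc d)
  bvec-scale*∂-diagonal d n = begin
    s * F * ∂ (bernCoeff d) (suc d) a     ≈⟨ *-congˡ ∂≈-F⁻¹ ⟩
    s * F * - F ⁻¹
      ≈⟨ solve 3 (λ s f i → s :* f :* (:- i) := :- (s :* (f :* i))) refl s F (F ⁻¹) ⟩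
    - (s * (F * F ⁻¹))
      ≈⟨ -‿cong (trans (*-congˡ (x*x⁻¹≈1 (fact*fact≉0 d a))) (*-identityʳ s)) ⟩
    - s
      ≈⟨ sym (trans (*-cong (pow-‿1-suc d) (reflexive (≡.cong fromℕ (nCn≡1 (suc d)))))
                    (trans (*-congˡ (+-identityʳ 1#)) (*-identityʳ _))) ⟩
    pow (- 1#) (suc d) * fromℕ (suc d C suc d) ∎
    where
    s = pow (- 1#) d
    a = n ∸ d
    F = fact d * fact a
    bernCoeff-d-d≈1 : bernCoeff d d a ≈ 1#
    bernCoeff-d-d≈1 = trans (bernCoeff-≥ {d} {d} a ℕₚ.≤-refl)
      (trans (reflexive (≡.cong (λ k → pow (- 1#) k * fromℕ (a C k)) (ℕₚ.n∸n≡0 d)))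
             (trans (*-identityˡ _) (+-identityʳ 1#)))
    ∂≈-F⁻¹ : ∂ (bernCoeff d) (suc d) a ≈ - F ⁻¹
    ∂≈-F⁻¹ = begin
      (fact (suc d) * fact a) ⁻¹ * (fromℕ a * bernCoeff d (suc d) (a ∸ 1) - fromℕ (suc d) * bernCoeff d d a)
        ≈⟨ *-congˡ (+-cong (trans (*-congˡ (bernCoeff-low (a ∸ 1) (ℕₚ.n<1+n d))) (zeroʳ _))
                           (-‿cong (trans (*-congˡ bernCoeff-d-d≈1) (*-identityʳ _)))) ⟩
      (fact (suc d) * fact a) ⁻¹ * (0# - fromℕ (suc d))   ≈⟨ *-congˡ (+-identityˡ _) ⟩
      (fact (suc d) * fact a) ⁻¹ * - fromℕ (suc d)
        ≈⟨ solve 2 (λ i s → i :* (:- s) := :- (s :* i)) refl ((fact (suc d) * fact a) ⁻¹) (fromℕ (suc d)) ⟩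
      - (fromℕ (suc d) * (fact (suc d) * fact a) ⁻¹)     ≈⟨ -‿cong ([1+j]*[[1+j]!*a!]⁻¹≈[j!*a!]⁻¹ d a) ⟩
      - F ⁻¹ ∎

  ∂-bernCoeff-bracket : ∀ {j d n} → j ≤ d → d ≤ n →
    fromℕ (suc (n ∸ j)) * bernCoeff d j (n ∸ j) - fromℕ j * bernCoeff d (j ∸ 1) (suc (n ∸ j)) ≈
    pow (- 1#) (d ∸ j) * fromℕ (suc d ℕ.* (suc (n ∸ j) C suc (d ∸ j)))
  ∂-bernCoeff-bracket {j} {d} {n} j≤d d≤n = begin
    fromℕ (suc a) * bernCoeff d j a - fromℕ j * bernCoeff d (j ∸ 1) (suc a)
      ≈⟨ +-cong (*-congˡ (bernCoeff-≥ a j≤d)) (-‿cong (second j j≤d)) ⟩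
    fromℕ (suc a) * (p * fromℕ (a C e)) - - (p * fromℕ (j ℕ.* C′))
      ≈⟨ solve 4 (λ u p v w → u :* (p :* v) :- (:- (p :* w)) := p :* (u :* v :+ w)) refl (fromℕ (suc a)) p _ _ ⟩
    p * (fromℕ (suc a) * fromℕ (a C e) + fromℕ (j ℕ.* C′))
      ≈⟨ *-congˡ (trans (+-congʳ (sym (fromℕ-* (suc a) (a C e)))) (sym (fromℕ-+ (suc a ℕ.* (a C e)) (j ℕ.* C′)))) ⟩
    p * fromℕ (suc a ℕ.* (a C e) ℕ.+ j ℕ.* C′)
      ≡⟨ ≡.cong (λ k → p * fromℕ k) ([1+a]*aCe+j*[1+a]C[1+e]≡[1+d]*[1+a]C[1+e] (ℕₚ.∸-monoˡ-≤ j d≤n) (≡.sym (ℕₚ.m+[n∸m]≡n j≤d))) ⟩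
    p * fromℕ (suc d ℕ.* C′) ∎
    where
    a = n ∸ j
    e = d ∸ j
    p = pow (- 1#) e
    C′ = suc a C suc e
    second : ∀ j′ → j′ ≤ d → fromℕ j′ * bernCoeff d (j′ ∸ 1) (suc (n ∸ j′)) ≈
                             - (pow (- 1#) (d ∸ j′) * fromℕ (j′ ℕ.* (suc (n ∸ j′) C suc (d ∸ j′))))
    second zero     _     = trans (zeroˡ _) (sym (trans (-‿cong (zeroʳ _)) -0#≈0#))
    second (suc j′) j′<d = begin
      fromℕ (suc j′) * bernCoeff d j′ (suc a′)
        ≈⟨ *-congˡ (bernCoeff-≥ (suc a′) (ℕₚ.<⇒≤ j′<d)) ⟩
      fromℕ (suc j′) * (pow (- 1#) (d ∸ j′) * fromℕ (suc a′ C (d ∸ j′)))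
        ≡⟨ ≡.cong (λ k → fromℕ (suc j′) * (pow (- 1#) k * fromℕ (suc a′ C k))) (ℕₚ.+-∸-assoc 1 j′<d) ⟩
      fromℕ (suc j′) * (pow (- 1#) (suc e′) * fromℕ (suc a′ C suc e′))
        ≈⟨ *-congˡ (*-congʳ (pow-‿1-suc e′)) ⟩
      fromℕ (suc j′) * (- pow (- 1#) e′ * fromℕ (suc a′ C suc e′))
        ≈⟨ solve 3 (λ u p c → u :* (:- p :* c) := :- (p :* (u :* c))) refl _ _ _ ⟩
      - (pow (- 1#) e′ * (fromℕ (suc j′) * fromℕ (suc a′ C suc e′)))
        ≈⟨ -‿cong (*-congˡ (sym (fromℕ-* (suc j′) (suc a′ C suc e′)))) ⟩
      - (pow (- 1#) e′ * fromℕ (suc j′ ℕ.* (suc a′ C suc e′))) ∎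
      where
      a′ = n ∸ suc j′
      e′ = d ∸ suc j′

  bvec-scale*∂-below : ∀ {j d n} → j ≤ d → d ≤ n →
    bvec-scale d n * ∂ (bernCoeff d) j (suc (n ∸ j)) ≈ pow (- 1#) j * fromℕ (suc d C j)
  bvec-scale*∂-below {j} {d} {n} j≤d d≤n = *-cancelʳ (fact*fact≉0 j (suc (n ∸ j))) (begin
    s * F * (I * b) * G
      ≈⟨ solve 5 (λ s f i b g → s :* f :* (i :* b) :* g := s :* f :* b :* (g :* i)) refl s F I b G ⟩
    s * F * b * (G * I)
      ≈⟨ trans (*-congˡ (x*x⁻¹≈1 (fact*fact≉0 j (suc (n ∸ j))))) (*-identityʳ _) ⟩
    s * F * b
      ≈⟨ *-congˡ (∂-bernCoeff-bracket j≤d d≤n) ⟩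
    s * F * (pow (- 1#) e * fromℕ (suc d ℕ.* C′))
      ≈⟨ solve 4 (λ s f p c → s :* f :* (p :* c) := s :* p :* (c :* f)) refl s F (pow (- 1#) e) (fromℕ (suc d ℕ.* C′)) ⟩
    s * pow (- 1#) e * (fromℕ (suc d ℕ.* C′) * F)
      ≈⟨ *-cong signs (sym (trans (fromℕ-* (suc d ℕ.* C′) (d ! ℕ.* (n ∸ d) !)) (*-congˡ (fromℕ-* (d !) ((n ∸ d) !))))) ⟩
    pow (- 1#) j * fromℕ (suc d ℕ.* C′ ℕ.* (d ! ℕ.* (n ∸ d) !))
      ≡⟨ ≡.cong (λ k → pow (- 1#) j * fromℕ k) ([1+d]*[1+n∸j]C[1+d∸j]*[d!*[n∸d]!]≡[1+d]Cj*[j!*[1+n∸j]!] j d n j≤d d≤n) ⟩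
    pow (- 1#) j * fromℕ ((suc d C j) ℕ.* (j ! ℕ.* suc (n ∸ j) !))
      ≈⟨ *-congˡ (trans (fromℕ-* (suc d C j) (j ! ℕ.* suc (n ∸ j) !)) (*-congˡ (fromℕ-* (j !) (suc (n ∸ j) !)))) ⟩
    pow (- 1#) j * (fromℕ (suc d C j) * G)
      ≈⟨ sym (*-assoc _ _ _) ⟩
    pow (- 1#) j * fromℕ (suc d C j) * G ∎)
    where
    s = pow (- 1#) d
    F = fact d * fact (n ∸ d)
    e = d ∸ j
    C′ = suc (n ∸ j) C suc e
    G = fact j * fact (suc (n ∸ j))
    I = G ⁻¹
    b = fromℕ (suc (n ∸ j)) * bernCoeff d j (n ∸ j) - fromℕ j * bernCoeff d (j ∸ 1) (suc (n ∸ j))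
    signs : s * pow (- 1#) e ≈ pow (- 1#) j
    signs = begin
      s * pow (- 1#) e
        ≡⟨ ≡.cong (λ k → pow (- 1#) k * pow (- 1#) e) (≡.sym (ℕₚ.m+[n∸m]≡n j≤d)) ⟩
      pow (- 1#) (j ℕ.+ e) * pow (- 1#) e           ≈⟨ *-congʳ (pow-+ (- 1#) j e) ⟩
      pow (- 1#) j * pow (- 1#) e * pow (- 1#) e    ≈⟨ *-assoc _ _ _ ⟩
      pow (- 1#) j * (pow (- 1#) e * pow (- 1#) e)  ≈⟨ trans (*-congˡ (pow-‿1-square e)) (*-identityʳ _) ⟩
      pow (- 1#) j ∎

  bvec≈bvec-scale*∂ₘ : ∀ {d n} → d ≤ n → ∀ (c : Fin (suc (suc n))) →
    bvec (suc (suc n)) (suc (suc d)) c ≈ bvec-scale d n * ∂ₘ (suc (suc n)) (bernCoeff d) c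
  bvec≈bvec-scale*∂ₘ {d} {n} d≤n c with ℕₚ.<-cmp (toℕ c) (suc d)
  ... | tri< c<1+d _ _ = begin
    bvec (suc (suc n)) (suc (suc d)) c                    ≡⟨ bvec-< (suc (suc d)) c (ℕₚ.m<n⇒m<1+n c<1+d) ⟩
    pow (- 1#) (toℕ c) * fromℕ (suc d C toℕ c)            ≈⟨ sym (bvec-scale*∂-below (ℕₚ.≤-pred c<1+d) d≤n) ⟩
    bvec-scale d n * ∂ (bernCoeff d) (toℕ c) (suc (n ∸ toℕ c))
      ≡⟨ ≡.cong (λ a → bvec-scale d n * ∂ (bernCoeff d) (toℕ c) a) (≡.sym (ℕₚ.+-∸-assoc 1 (ℕₚ.≤-trans (ℕₚ.≤-pred c<1+d) d≤n))) ⟩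
    bvec-scale d n * ∂ₘ (suc (suc n)) (bernCoeff d) c ∎
  ... | tri≈ _ c≡1+d _ = begin
    bvec (suc (suc n)) (suc (suc d)) c
      ≡⟨ bvec-< (suc (suc d)) c (≡.subst (_< suc (suc d)) (≡.sym c≡1+d) (ℕₚ.n<1+n (suc d))) ⟩
    pow (- 1#) (toℕ c) * fromℕ (suc d C toℕ c)
      ≡⟨ ≡.cong (λ j → pow (- 1#) j * fromℕ (suc d C j)) c≡1+d ⟩
    pow (- 1#) (suc d) * fromℕ (suc d C suc d)            ≈⟨ sym (bvec-scale*∂-diagonal d n) ⟩
    bvec-scale d n * ∂ (bernCoeff d) (suc d) (n ∸ d)
      ≡⟨ ≡.cong (λ j → bvec-scale d n * ∂ (bernCoeff d) j (suc n ∸ j)) (≡.sym c≡1+d) ⟩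
    bvec-scale d n * ∂ₘ (suc (suc n)) (bernCoeff d) c ∎
  ... | tri> _ _ 1+d<c = trans (reflexive (bvec-≥ (suc (suc d)) c 1+d<c))
                               (sym (trans (*-congˡ (∂-bernCoeff-low (suc n ∸ toℕ c) 1+d<c)) (zeroʳ _)))

  Σ-t*bvec≈0 : ∀ {d n} → d ≤ n → ∀ {nT} (t : Fin nT → Carrier) (τ : Fin nT → Fin (suc (suc n))) →
    Σ nT (λ j → t j * ∂ₘ (suc (suc n)) (bernCoeff d) (τ j)) ≈ 0# →
    Σ nT (λ j → t j * bvec (suc (suc n)) (suc (suc d)) (τ j)) ≈ 0#
  Σ-t*bvec≈0 {d} {n} d≤n {nT} t τ Σ≈0 = begin
    Σ nT (λ j → t j * bvec (suc (suc n)) (suc (suc d)) (τ j))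
      ≈⟨ Σ-cong nT (λ j → trans (*-congˡ (bvec≈bvec-scale*∂ₘ d≤n (τ j))) (x∙yz≈y∙xz (t j) _ _)) ⟩
    Σ nT (λ j → bvec-scale d n * (t j * ∂ₘ (suc (suc n)) (bernCoeff d) (τ j)))
      ≈⟨ Σ-*ˡ nT (bvec-scale d n) (λ j → t j * ∂ₘ (suc (suc n)) (bernCoeff d) (τ j)) ⟩
    bvec-scale d n * Σ nT (λ j → t j * ∂ₘ (suc (suc n)) (bernCoeff d) (τ j))
      ≈⟨ trans (*-congˡ Σ≈0) (zeroʳ _) ⟩
    0# ∎

  permMat-≡ : ∀ {K} (π : Permutation′ K) r c → π ⟨$⟩ʳ r ≡ c → permMat π r c ≈ 1#
  permMat-≡ π r c πr≡c with π ⟨$⟩ʳ r Fin.≟ c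
  ... | yes _    = refl
  ... | no πr≢c = ⊥-elim (πr≢c πr≡c)

  permMat-≢ : ∀ {K} (π : Permutation′ K) r c → π ⟨$⟩ʳ r ≢ c → permMat π r c ≈ 0#
  permMat-≢ π r c πr≢c with π ⟨$⟩ʳ r Fin.≟ c
  ... | yes πr≡c = ⊥-elim (πr≢c πr≡c)
  ... | no _     = refl

  Σ-[Σt*M]*v : ∀ {K} n (t : Fin n → Carrier) (M : Fin n → Fin K → Carrier) (v : Fin K → Carrier) →
    Σ K (λ c → Σ n (λ j → t j * M j c) * v c) ≈ Σ n (λ j → t j * Σ K (λ c → M j c * v c))
  Σ-[Σt*M]*v {K} n t M v = begin
    Σ K (λ c → Σ n (λ j → t j * M j c) * v c)
      ≈⟨ Σ-cong K (λ c → trans (*-comm _ _) (trans (sym (Σ-*ˡ n (v c) (λ j → t j * M j c)))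
           (Σ-cong n (λ j → solve 3 (λ v t m → v :* (t :* m) := t :* (m :* v)) refl (v c) (t j) (M j c))))) ⟩
    Σ K (λ c → Σ n (λ j → t j * (M j c * v c)))   ≈⟨ Σ-comm K n (λ c j → t j * (M j c * v c)) ⟩
    Σ n (λ j → Σ K (λ c → t j * (M j c * v c)))   ≈⟨ Σ-cong n (λ j → Σ-*ˡ K (t j) (λ c → M j c * v c)) ⟩
    Σ n (λ j → t j * Σ K (λ c → M j c * v c)) ∎

  cover-*ʳ : ∀ {K} n (t : Fin n → Carrier) (σ : Fin n → Permutation′ K) (v : Fin K → Carrier) row →
    Σ K (λ c → cover n t σ row c * v c) ≈ Σ n (λ j → t j * v (σ j ⟨$⟩ʳ row))
  cover-*ʳ {K} n t σ v row = trans (Σ-[Σt*M]*v n t (λ j c → permMat (σ j) row c) v) (Σ-cong n (λ j →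
    *-congˡ (Σ-select K (σ j ⟨$⟩ʳ row) (permMat (σ j) row) v (permMat-≡ (σ j) row) (permMat-≢ (σ j) row))))

  *-cover : ∀ {K} n (t : Fin n → Carrier) (σ : Fin n → Permutation′ K) (v : Fin K → Carrier) col →
    Σ K (λ row → v row * cover n t σ row col) ≈ Σ n (λ j → t j * v (flip (σ j) ⟨$⟩ʳ col))
  *-cover {K} n t σ v col = trans (Σ-cong K (λ row → *-comm _ _))
    (trans (Σ-[Σt*M]*v n t (λ j row → permMat (σ j) row col) v) (Σ-cong n (λ j →
      *-congˡ (Σ-select K (flip (σ j) ⟨$⟩ʳ col) (λ row → permMat (σ j) row col) v
        (λ row σ⁻¹col≡row → permMat-≡ (σ j) row col (≡.trans (≡.cong (σ j ⟨$⟩ʳ_) (≡.sym σ⁻¹col≡row)) (inverseʳ (σ j))))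
        (λ row σ⁻¹col≢row → permMat-≢ (σ j) row col λ σrow≡col →
           σ⁻¹col≢row (≡.trans (≡.cong (flip (σ j) ⟨$⟩ʳ_) (≡.sym σrow≡col)) (inverseˡ (σ j))))))))

lemma8 : (ℝ : RealField) → let open RealField ℝ in let open WithReals ℝ in
    (n r : ℕ) (ord : Fin (n Data.Nat.+ r) → ℕ)
    (π : (i : Fin (n Data.Nat.+ r)) → Permutation′ (ord i))
    (t : Fin (n Data.Nat.+ r) → Carrier) →
    (∀ α β → ¬ (α ≈ 0#) → ¬ (α ≈ 1#) → ¬ (β ≈ 0#) → ¬ (β ≈ 1#) →
      Σ (n Data.Nat.+ r) (λ i → t i * P (π i) α β) ≈ 0#) →
    (k : ℕ) → k ≡ maxℕ (n Data.Nat.+ r) ord →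
    (first : ∀ (j : Fin n) → ord (j ↑ˡ r) ≡ k) →
    (∀ (j : Fin r) → ord (n ↑ʳ j) ≢ k) →
    (h : ℕ) → 2 ≤ h → h ≤ k →
    (∀ (j : Fin r) → ord (n ↑ʳ j) ≤ h ∸ 1) →
    let C = cover n (λ j → t (j ↑ˡ r)) (λ j → subst Permutation′ (first j) (π (j ↑ˡ r)))
        b = bvec k h
    in (∀ row → Σ k (λ c → C row c * b c) ≈ 0#)
     × (∀ col → Σ k (λ row → b row * C row col) ≈ 0#)
lemma8 ℝ n r ord π t P≈0 _ _ first _ _ (s≤s (s≤s z≤n)) (s≤s (s≤s {d} {m} d≤m)) ord≤1+d =
    (λ row → trans (cover-*ʳ n tT σT b row) (Σ-t*bvec≈0 d≤m tT (λ j → σT j ⟨$⟩ʳ row)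
       (Σ-t*∂ₘ-bernCoeff≈0 d≤m tT σT tL σL ord≤1+d split row)))
  , (λ col → trans (*-cover n tT σT b col) (Σ-t*bvec≈0 d≤m tT (λ j → flip (σT j) ⟨$⟩ʳ col)
       (Σ-t*∂ₘ-bernCoeff≈0 d≤m tT (λ j → flip (σT j)) tL (λ j → flip (σL j)) ord≤1+d
          (VanishingCombination-flip tT σT tL σL split) col)))
  where
  open RealField ℝ
  open WithReals ℝ
  open GradientPolynomials ℝ
  tT : Fin n → Carrier
  tT j = t (j ↑ˡ r)
  σT : Fin n → Permutation′ (suc (suc m))
  σT j = subst Permutation′ (first j) (π (j ↑ˡ r))
  tL : Fin r → Carrier
  tL j = t (n ↑ʳ j)
  σL : (j : Fin r) → Permutation′ (ord (n ↑ʳ j))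
  σL j = π (n ↑ʳ j)
  b : Fin (suc (suc m)) → Carrier
  b = bvec (suc (suc m)) (suc (suc d))
  split : VanishingCombination tT σT tL σL
  split x y x≉0 x≉1 y≉0 y≉1 = trans (+-congʳ (Σ-cong n (λ j → *-congˡ (P-subst (first j) (π (j ↑ˡ r))))))
    (trans (sym (Σ-splitAt n r (λ i → t i * P (π i) x y))) (P≈0 x y x≉0 x≉1 y≉0 y≉1))
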